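{- For each even integer $t \ge 4$ define \begin{align*} U_t(x) &= 2x^{2t-1} + x^{t+3} - x^{t+2} + x^{t+1} - 3x^t + 3x^{t-1} - x^{t-2} + x^{t-3} - x^{t-4} - 2,\\ W_t(x) &= 2x^{2t-1} - x^{t+3} + x^{t+2} - x^{t+1} - x^t + x^{t-1} + x^{t-2} - x^{t-3} + x^{t-4} - 2. \end{align*} For each even $t \ge 4$ and each prime $p \ge 11$, neither $U_t(x)$ nor $W_t(x)$ is divisible by $\Phi_p(x)$ or by $\Phi_{2p}(x)$.
   Context: $\Phi_b(x)$ denotes the $b$-th cyclotomic polynomial, $\Phi_b(x) = \prod_\xi (x - \xi)$ with $\xi$ ranging over the primitive $b$-th roots of unity; divisibility is in $\mathbb{Q}[x]$. -}

module Defs where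

open import Data.Nat as ℕ using (ℕ; zero; suc; _∸_; _<ᵇ_)
open import Data.Nat.Divisibility using (_∣?_)
open import Data.Integer as ℤ using (ℤ; +_; -[1+_])
open import Data.Rational as ℚ using (ℚ)
open import Data.List using (List; []; _∷_; _++_; [_]; map; length; replicate; foldr)
open import Data.Bool using (Bool; true; false; if_then_else_)
open import Relation.Nullary.Decidable using (does)
open import Relation.Binary.PropositionalEquality using (_≡_)
open import Data.Product using (∃; _×_; _,_)

-- Polynomials are coefficient lists, lowest degree first.
-- Generic polynomial operations over a (raw) semiring of coefficients.
module PolyOps {A : Set} (0# : A) (_⊕_ _⊗_ : A → A → A) where
  coeff : List A → ℕ → A
  coeff []       _       = 0#
  coeff (a ∷ p)  zero    = a
  coeff (a ∷ p)  (suc i) = coeff p i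

  addP : List A → List A → List A
  addP []       q        = q
  addP (a ∷ p)  []       = a ∷ p
  addP (a ∷ p)  (b ∷ q)  = (a ⊕ b) ∷ addP p q

  scaleP : A → List A → List A
  scaleP c = map (c ⊗_)

  mulP : List A → List A → List A
  mulP []       q = []
  mulP (a ∷ p)  q = addP (scaleP a q) (0# ∷ mulP p q)

  monomial : A → ℕ → List A
  monomial c k = replicate k 0# ++ [ c ]

module ZP = PolyOps (+ 0) ℤ._+_ ℤ._*_
module QP = PolyOps ℚ.0ℚ ℚ._+_ ℚ._*_

open ZP using () renaming (addP to _+ᶻ_; mulP to _*ᶻ_; monomial to monᶻ)

negᶻ : List ℤ → List ℤ
negᶻ = map (λ z → ℤ.- z)

trim : List ℤ → List ℤ
trim []      = []
trim (a ∷ p) with trim p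
... | []    = if does (a ℤ.≟ + 0) then [] else [ a ]
... | b ∷ q = a ∷ b ∷ q

lastOr : {A : Set} → A → List A → A
lastOr d []       = d
lastOr d (a ∷ p)  = lastOr a p

-- Quotient of long division of a by a MONIC polynomial b over ℤ
-- (first argument is fuel; fuel ≥ deg a + 1 suffices).
quotMonic : ℕ → List ℤ → List ℤ → List ℤ
quotMonic zero    a b = []
quotMonic (suc f) a b =
  let a' = trim a ; b' = trim b ; n = length a' ; m = length b' in
  if n <ᵇ m then [] else
  (let k = n ∸ m ; c = lastOr (+ 0) a' in
   monᶻ c k +ᶻ quotMonic f (trim (a' +ᶻ negᶻ (monᶻ c k *ᶻ b'))) b')

xnm1 : ℕ → List ℤ
xnm1 n = monᶻ (+ 1) n +ᶻ [ -[1+ 0 ] ]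

-- product of the polynomials in the table (table entry i is Φ_{i+1})
-- whose index d divides n; d is the index of the head of the list.
prodDivisors : ℕ → ℕ → List (List ℤ) → List ℤ
prodDivisors n d []        = [ + 1 ]
prodDivisors n d (φ ∷ φs) =
  (if does (d ∣? n) then φ else [ + 1 ]) *ᶻ prodDivisors n (suc d) φs

-- cycTable n = [Φ_1, …, Φ_n], defined by x^n - 1 = ∏_{d ∣ n} Φ_d, i.e.
-- Φ_n = (x^n - 1) / ∏_{d ∣ n, d < n} Φ_d  (exact division by a monic polynomial)
cycTable : ℕ → List (List ℤ)
cycTable zero    = []
cycTable (suc n) =
  let T = cycTable n in
  T ++ [ trim (quotMonic (suc (suc n)) (xnm1 (suc n)) (prodDivisors (suc n) 1 T)) ]

-- The n-th cyclotomic polynomial Φ_n (n ≥ 1), integer coefficients.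
-- (Φ_0 is a junk value [1]; it is never used.)
Φ : ℕ → List ℤ
Φ n = lastOr [ + 1 ] (cycTable n)

toℚ : List ℤ → List ℚ
toℚ = map (λ z → z ℚ./ 1)

_∣ℚ[x]_ : List ℤ → List ℤ → Set
f ∣ℚ[x] g = ∃ λ (q : List ℚ) → ∀ i → QP.coeff (toℚ g) i ≡ QP.coeff (QP.mulP (toℚ f) q) i

poly : List (ℤ × ℕ) → List ℤ
poly []            = []
poly ((c , k) ∷ r) = monᶻ c k +ᶻ poly r

U : ℕ → List ℤ
U t = poly ( (+ 2 , 2 ℕ.* t ∸ 1) ∷ (+ 1 , t ℕ.+ 3) ∷ (-[1+ 0 ] , t ℕ.+ 2) ∷ (+ 1 , t ℕ.+ 1)
           ∷ (-[1+ 2 ] , t) ∷ (+ 3 , t ∸ 1) ∷ (-[1+ 0 ] , t ∸ 2) ∷ (+ 1 , t ∸ 3)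
           ∷ (-[1+ 0 ] , t ∸ 4) ∷ (-[1+ 1 ] , 0) ∷ [])

W : ℕ → List ℤ
W t = poly ( (+ 2 , 2 ℕ.* t ∸ 1) ∷ (-[1+ 0 ] , t ℕ.+ 3) ∷ (+ 1 , t ℕ.+ 2) ∷ (-[1+ 0 ] , t ℕ.+ 1)
           ∷ (-[1+ 0 ] , t) ∷ (+ 1 , t ∸ 1) ∷ (+ 1 , t ∸ 2) ∷ (-[1+ 0 ] , t ∸ 3)
           ∷ (+ 1 , t ∸ 4) ∷ (-[1+ 1 ] , 0) ∷ [])

module Submission where

-- Write p = p′ + 1. For a prime p ≥ 11 the defining recursion gives, by exact long division,
-- Φ p = 1 + x + ⋯ + x^p′ and Φ (2p) = 1 - x + ⋯ + x^p′, i.e. Φ = Σ σⁱ xⁱ with σ = ±1, and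
-- (σx - 1) Φ = σᵖ xᵖ - 1. Hence if Φ divides V, the coefficients r₀, …, r_p′ of the remainder of
-- V modulo xᵖ - σ satisfy r_{k+1} = σ r_k: either all of them vanish or none does. For U_t and W_t,
-- r_k is a signed sum of the coefficients whose exponents are ≡ k (mod p). As p > 10 the exponents
-- t - 4, …, t + 6 have distinct residues, and the outer exponents 2t - 1 and 0 occupy at most two
-- residue classes; so one of the classes of t + 4, t + 5, t + 6 contains no exponent (r = 0), and one
-- of the classes of t, t + 1, t + 2 contains a single exponent, whose coefficient is nonzero (r ≠ 0).

open import Defs
open import Algebra.Bundles using (CommutativeRing; Semiring)
open import Algebra.Core using (Op₁; Op₂)
import Algebra.Structures as Structures
import Algebra.Properties.CommutativeSemigroup as CommSemigroupProperties
import Algebra.Properties.Ring as RingProperties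
import Algebra.Definitions.RawSemiring as RawSemiringDefinitions
open import Data.Bool using (false; true; T)
open import Data.Empty using (⊥; ⊥-elim)
open import Data.Integer as ℤ using (ℤ)
import Data.Integer.Properties as ℤP
open import Data.List using (List; []; _∷_; [_]; _++_; _∷ʳ_; replicate; length; map; applyUpTo)
open import Data.List.Properties using (length-map; length-++; length-applyUpTo; applyUpTo-∷ʳ; ++-identityʳ; map-++; map-replicate)
open import Data.List.Relation.Unary.All using (All; []; _∷_)
open import Data.List.Reverse using (Reverse; []; _∶_∶ʳ_; reverseView)
open import Data.Nat as ℕ using (ℕ; zero; suc; _≤_; _<_; _∸_; z≤n; s≤s; _≤?_; _<?_)
import Data.Nat.Properties as ℕP
open import Data.Nat.Coprimality using (Coprime; coprime-divisor)
import Data.Nat.Coprimality as Coprimality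
open import Data.Nat.Divisibility using (_∣_; _∣?_; divides; 1∣_; n∣m*n; m∣m*n; *-cancelʳ-∣; m%n≡0⇒n∣m)
open import Data.Nat.DivMod using (_/_; _%_; m≡m%n+[m/n]*n; m%n<n; %-distribˡ-+; m<n⇒m%n≡m; [m+n]%n≡m%n)
open import Data.Nat.Primality using (Prime; prime⇒irreducible; prime⇒nonZero; irreducible[2])
open import Data.Nat.Tactic.RingSolver using (solve-∀)
open import Data.Product using (_×_; _,_; proj₁; proj₂; ∃-syntax; map₁)
open import Data.Rational as ℚ using (ℚ; mkℚ; 0ℚ; 1ℚ)
import Data.Rational.Properties as ℚP
open import Data.Sum using (_⊎_; inj₁; inj₂)
open import Data.Vec using (Vec; []; _∷_)
import Data.Vec as Vec
open import Function using (_∘_)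
open import Level using (0ℓ)
open import Relation.Binary.Bundles using (Setoid)
open import Relation.Binary.Definitions using (DecidableEquality; tri<; tri≈; tri>)
open import Relation.Binary.PropositionalEquality hiding ([_])
open import Relation.Nullary using (Dec; yes; no; ¬_)
open import Relation.Nullary.Decidable using (True; toWitness; dec-true; dec-false)
import Relation.Binary.Reasoning.Setoid as SetoidReasoning

module RingPolynomials {A : Set} {add mul : Op₂ A} {neg : Op₁ A} {0# 1# : A}
  (isCommutativeRing : Structures.IsCommutativeRing {A = A} _≡_ add mul neg 0# 1#) where

  infixl 6 _+_
  infixl 7 _*_
  infix  8 -_

  _+_ _*_ : Op₂ A
  _+_ = add
  _*_ = mul

  -_ : Op₁ A
  -_ = neg

  ring : CommutativeRing 0ℓ 0ℓ
  ring = record { isCommutativeRing = isCommutativeRing }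

  open CommutativeRing ring public
    using (+-assoc; +-comm; +-identityˡ; +-identityʳ; -‿inverseˡ; -‿inverseʳ;
           *-assoc; *-comm; *-identityˡ; *-identityʳ; zeroˡ; zeroʳ; distribˡ)
  open RingProperties (CommutativeRing.ring ring) using (-0#≈0#; -1*x≈-x)
  open CommSemigroupProperties (CommutativeRing.+-commutativeSemigroup ring)
    using (interchange; x∙yz≈y∙xz)
  open CommSemigroupProperties (CommutativeRing.*-commutativeSemigroup ring)
    using () renaming (interchange to *-interchange; x∙yz≈y∙xz to *-x∙yz≈y∙xz)
  open RawSemiringDefinitions (Semiring.rawSemiring (CommutativeRing.semiring ring)) public using (_^_)
  open PolyOps 0# _+_ _*_ public

  infix 4 _≈_
  record _≈_ (f g : List A) : Set where
    constructor coeffwise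
    field at : ∀ i → coeff f i ≡ coeff g i
  open _≈_ public

  ≈-refl : ∀ {f} → f ≈ f
  ≈-refl = coeffwise λ _ → refl

  ≈-sym : ∀ {f g} → f ≈ g → g ≈ f
  ≈-sym e = coeffwise λ i → sym (at e i)

  ≈-trans : ∀ {f g h} → f ≈ g → g ≈ h → f ≈ h
  ≈-trans e e′ = coeffwise λ i → trans (at e i) (at e′ i)

  ≈-reflexive : ∀ {f g} → f ≡ g → f ≈ g
  ≈-reflexive refl = ≈-refl

  ≈-setoid : Setoid 0ℓ 0ℓ
  ≈-setoid = record
    { Carrier = List A ; _≈_ = _≈_
    ; isEquivalence = record { refl = ≈-refl ; sym = ≈-sym ; trans = ≈-trans } }

  shift : ℕ → List A → List A
  shift k f = replicate k 0# ++ f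

  coeff-addP : ∀ f g i → coeff (addP f g) i ≡ coeff f i + coeff g i
  coeff-addP []      g       i       = sym (+-identityˡ _)
  coeff-addP (a ∷ f) []      i       = sym (+-identityʳ _)
  coeff-addP (a ∷ f) (b ∷ g) zero    = refl
  coeff-addP (a ∷ f) (b ∷ g) (suc i) = coeff-addP f g i

  coeff-scaleP : ∀ c f i → coeff (scaleP c f) i ≡ c * coeff f i
  coeff-scaleP c []      i       = sym (zeroʳ c)
  coeff-scaleP c (a ∷ f) zero    = refl
  coeff-scaleP c (a ∷ f) (suc i) = coeff-scaleP c f i

  coeff-neg : ∀ f i → coeff (map -_ f) i ≡ - coeff f i
  coeff-neg []      i       = sym -0#≈0#
  coeff-neg (a ∷ f) zero    = refl
  coeff-neg (a ∷ f) (suc i) = coeff-neg f i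

  coeff-≥length : ∀ f {i} → length f ≤ i → coeff f i ≡ 0#
  coeff-≥length []      _         = refl
  coeff-≥length (a ∷ f) (s≤s len≤i) = coeff-≥length f len≤i

  coeff-shift-< : ∀ k f {i} → i < k → coeff (shift k f) i ≡ 0#
  coeff-shift-< (suc k) f {zero}  _         = refl
  coeff-shift-< (suc k) f {suc i} (s≤s i<k) = coeff-shift-< k f i<k

  coeff-shift-+ : ∀ k f j → coeff (shift k f) (k ℕ.+ j) ≡ coeff f j
  coeff-shift-+ zero    f j = refl
  coeff-shift-+ (suc k) f j = coeff-shift-+ k f j

  shift-+ : ∀ a b f → shift (a ℕ.+ b) f ≡ shift a (shift b f)
  shift-+ zero    b f = refl
  shift-+ (suc a) b f = cong (0# ∷_) (shift-+ a b f)

  ∷-cong : ∀ {a b f g} → a ≡ b → f ≈ g → (a ∷ f) ≈ (b ∷ g)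
  ∷-cong a≡b f≈g = coeffwise λ { zero → a≡b ; (suc i) → at f≈g i }

  ∷-tail : ∀ {a b f g} → (a ∷ f) ≈ (b ∷ g) → f ≈ g
  ∷-tail e = coeffwise (at e ∘ suc)

  ∷-tail-zero : ∀ {a f} → (a ∷ f) ≈ [] → f ≈ []
  ∷-tail-zero e = coeffwise (at e ∘ suc)

  0∷-zero : ∀ {f} → f ≈ [] → (0# ∷ f) ≈ []
  0∷-zero f≈0 = coeffwise λ { zero → refl ; (suc i) → at f≈0 i }

  shift-cong : ∀ k {f g} → f ≈ g → shift k f ≈ shift k g
  shift-cong zero    f≈g = f≈g
  shift-cong (suc k) f≈g = ∷-cong refl (shift-cong k f≈g)

  addP-cong : ∀ {f f′ g g′} → f ≈ f′ → g ≈ g′ → addP f g ≈ addP f′ g′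
  addP-cong {f} {f′} {g} {g′} f≈f′ g≈g′ = coeffwise λ i → begin
    coeff (addP f g) i       ≡⟨ coeff-addP f g i ⟩
    coeff f i + coeff g i    ≡⟨ cong₂ _+_ (at f≈f′ i) (at g≈g′ i) ⟩
    coeff f′ i + coeff g′ i  ≡⟨ coeff-addP f′ g′ i ⟨
    coeff (addP f′ g′) i     ∎
    where open ≡-Reasoning

  addP-comm : ∀ f g → addP f g ≈ addP g f
  addP-comm f g = coeffwise λ i → begin
    coeff (addP f g) i     ≡⟨ coeff-addP f g i ⟩
    coeff f i + coeff g i  ≡⟨ +-comm _ _ ⟩
    coeff g i + coeff f i  ≡⟨ coeff-addP g f i ⟨
    coeff (addP g f) i     ∎
    where open ≡-Reasoning

  scaleP-cong : ∀ c {f g} → f ≈ g → scaleP c f ≈ scaleP c g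
  scaleP-cong c {f} {g} f≈g = coeffwise λ i → begin
    coeff (scaleP c f) i  ≡⟨ coeff-scaleP c f i ⟩
    c * coeff f i         ≡⟨ cong (c *_) (at f≈g i) ⟩
    c * coeff g i         ≡⟨ coeff-scaleP c g i ⟨
    coeff (scaleP c g) i  ∎
    where open ≡-Reasoning

  scaleP-addP : ∀ c f g → scaleP c (addP f g) ≈ addP (scaleP c f) (scaleP c g)
  scaleP-addP c f g = coeffwise λ i → begin
    coeff (scaleP c (addP f g)) i               ≡⟨ coeff-scaleP c (addP f g) i ⟩
    c * coeff (addP f g) i                      ≡⟨ cong (c *_) (coeff-addP f g i) ⟩
    c * (coeff f i + coeff g i)                 ≡⟨ distribˡ c _ _ ⟩
    c * coeff f i + c * coeff g i               ≡⟨ cong₂ _+_ (coeff-scaleP c f i) (coeff-scaleP c g i) ⟨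
    coeff (scaleP c f) i + coeff (scaleP c g) i ≡⟨ coeff-addP (scaleP c f) (scaleP c g) i ⟨
    coeff (addP (scaleP c f) (scaleP c g)) i    ∎
    where open ≡-Reasoning

  scaleP-scaleP : ∀ c a f → scaleP c (scaleP a f) ≈ scaleP (c * a) f
  scaleP-scaleP c a f = coeffwise λ i → begin
    coeff (scaleP c (scaleP a f)) i  ≡⟨ trans (coeff-scaleP c (scaleP a f) i) (cong (c *_) (coeff-scaleP a f i)) ⟩
    c * (a * coeff f i)              ≡⟨ *-assoc c a _ ⟨
    c * a * coeff f i                ≡⟨ coeff-scaleP (c * a) f i ⟨
    coeff (scaleP (c * a) f) i       ∎
    where open ≡-Reasoning

  neg-cong : ∀ {f g} → f ≈ g → map -_ f ≈ map -_ g
  neg-cong {f} {g} f≈g = coeffwise λ i → trans (coeff-neg f i) (trans (cong -_ (at f≈g i)) (sym (coeff-neg g i)))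

  scaleP-zero : ∀ f → scaleP 0# f ≈ []
  scaleP-zero f = coeffwise λ i → trans (coeff-scaleP 0# f i) (zeroˡ _)

  mulP-0∷ : ∀ f g → mulP (0# ∷ f) g ≈ (0# ∷ mulP f g)
  mulP-0∷ f g = addP-cong (scaleP-zero g) ≈-refl

  mulP-zeroˡ : ∀ {f} g → f ≈ [] → mulP f g ≈ []
  mulP-zeroˡ {[]}    g f≈0 = ≈-refl
  mulP-zeroˡ {a ∷ f} g f≈0 = begin
    addP (scaleP a g) (0# ∷ mulP f g)   ≈⟨ addP-cong a·g≈0·g (∷-cong refl (mulP-zeroˡ g (∷-tail-zero f≈0))) ⟩
    addP (scaleP 0# g) (0# ∷ [])        ≈⟨ addP-cong (scaleP-zero g) ≈-refl ⟩
    0# ∷ []                             ≈⟨ 0∷-zero ≈-refl ⟩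
    []                                  ∎
    where
    open SetoidReasoning ≈-setoid
    a·g≈0·g : scaleP a g ≈ scaleP 0# g
    a·g≈0·g = coeffwise λ i → cong (λ c → coeff (scaleP c g) i) (at f≈0 0)

  mulP-zeroʳ : ∀ f → mulP f [] ≈ []
  mulP-zeroʳ []      = ≈-refl
  mulP-zeroʳ (a ∷ f) = 0∷-zero (mulP-zeroʳ f)

  mulP-congʳ : ∀ f {g g′} → g ≈ g′ → mulP f g ≈ mulP f g′
  mulP-congʳ []      g≈g′ = ≈-refl
  mulP-congʳ (a ∷ f) g≈g′ = addP-cong (scaleP-cong a g≈g′) (∷-cong refl (mulP-congʳ f g≈g′))

  mulP-congˡ : ∀ {f f′} g → f ≈ f′ → mulP f g ≈ mulP f′ g
  mulP-congˡ {[]}    {f′}     g f≈f′ = ≈-sym (mulP-zeroˡ g (≈-sym f≈f′))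
  mulP-congˡ {a ∷ f} {[]}     g f≈f′ = mulP-zeroˡ g f≈f′
  mulP-congˡ {a ∷ f} {b ∷ f′} g f≈f′ =
    addP-cong (coeffwise λ i → cong (λ c → coeff (scaleP c g) i) (at f≈f′ 0))
              (∷-cong refl (mulP-congˡ g (∷-tail f≈f′)))

  addP-identityʳ : ∀ f → addP f [] ≡ f
  addP-identityʳ []      = refl
  addP-identityʳ (a ∷ f) = refl

  mulP-singleton : ∀ c f → mulP [ c ] f ≈ scaleP c f
  mulP-singleton c f = ≈-trans (addP-cong ≈-refl (0∷-zero ≈-refl)) (≈-reflexive (addP-identityʳ (scaleP c f)))

  mulP-identityˡ : ∀ f → mulP [ 1# ] f ≈ f
  mulP-identityˡ f = ≈-trans (mulP-singleton 1# f) (coeffwise λ i → trans (coeff-scaleP 1# f i) (*-identityˡ _))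

  mulP-∷ʳ : ∀ f a g → mulP f (a ∷ g) ≈ addP (scaleP a f) (0# ∷ mulP f g)
  mulP-∷ʳ []      a g = coeffwise λ { zero → refl ; (suc i) → refl }
  mulP-∷ʳ (b ∷ f) a g = ∷-cong (cong (_+ 0#) (*-comm b a)) (coeffwise λ i → begin
    coeff (addP (scaleP b g) (mulP f (a ∷ g))) i
      ≡⟨ coeff-addP (scaleP b g) _ i ⟩
    coeff (scaleP b g) i + coeff (mulP f (a ∷ g)) i
      ≡⟨ cong (_ +_) (trans (at (mulP-∷ʳ f a g) i) (coeff-addP (scaleP a f) _ i)) ⟩
    coeff (scaleP b g) i + (coeff (scaleP a f) i + coeff (0# ∷ mulP f g) i)
      ≡⟨ x∙yz≈y∙xz _ _ _ ⟩
    coeff (scaleP a f) i + (coeff (scaleP b g) i + coeff (0# ∷ mulP f g) i)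
      ≡⟨ cong (_ +_) (coeff-addP (scaleP b g) _ i) ⟨
    coeff (scaleP a f) i + coeff (mulP (b ∷ f) g) i
      ≡⟨ coeff-addP (scaleP a f) _ i ⟨
    coeff (addP (scaleP a f) (mulP (b ∷ f) g)) i
      ∎)
    where open ≡-Reasoning

  mulP-comm : ∀ f g → mulP f g ≈ mulP g f
  mulP-comm []      g = ≈-sym (mulP-zeroʳ g)
  mulP-comm (a ∷ f) g = ≈-trans (addP-cong ≈-refl (∷-cong refl (mulP-comm f g))) (≈-sym (mulP-∷ʳ g a f))

  0∷-addP : ∀ f g → (0# ∷ addP f g) ≈ addP (0# ∷ f) (0# ∷ g)
  0∷-addP f g = ∷-cong (sym (+-identityʳ 0#)) ≈-refl

  addP-interchange : ∀ f g f′ g′ → addP (addP f g) (addP f′ g′) ≈ addP (addP f f′) (addP g g′)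
  addP-interchange f g f′ g′ = coeffwise λ i → begin
    coeff (addP (addP f g) (addP f′ g′)) i
      ≡⟨ trans (coeff-addP (addP f g) _ i) (cong₂ _+_ (coeff-addP f g i) (coeff-addP f′ g′ i)) ⟩
    (coeff f i + coeff g i) + (coeff f′ i + coeff g′ i)
      ≡⟨ interchange _ _ _ _ ⟩
    (coeff f i + coeff f′ i) + (coeff g i + coeff g′ i)
      ≡⟨ trans (coeff-addP (addP f f′) _ i) (cong₂ _+_ (coeff-addP f f′ i) (coeff-addP g g′ i)) ⟨
    coeff (addP (addP f f′) (addP g g′)) i
      ∎
    where open ≡-Reasoning

  mulP-distribˡ : ∀ f g h → mulP f (addP g h) ≈ addP (mulP f g) (mulP f h)
  mulP-distribˡ []      g h = ≈-refl
  mulP-distribˡ (a ∷ f) g h = begin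
    addP (scaleP a (addP g h)) (0# ∷ mulP f (addP g h))
      ≈⟨ addP-cong (scaleP-addP a g h) (≈-trans (∷-cong refl (mulP-distribˡ f g h)) (0∷-addP (mulP f g) (mulP f h))) ⟩
    addP (addP (scaleP a g) (scaleP a h)) (addP (0# ∷ mulP f g) (0# ∷ mulP f h))
      ≈⟨ addP-interchange (scaleP a g) (scaleP a h) _ _ ⟩
    addP (mulP (a ∷ f) g) (mulP (a ∷ f) h)
      ∎
    where open SetoidReasoning ≈-setoid

  mulP-distribʳ : ∀ f g h → mulP (addP f g) h ≈ addP (mulP f h) (mulP g h)
  mulP-distribʳ f g h = begin
    mulP (addP f g) h            ≈⟨ mulP-comm (addP f g) h ⟩
    mulP h (addP f g)            ≈⟨ mulP-distribˡ h f g ⟩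
    addP (mulP h f) (mulP h g)   ≈⟨ addP-cong (mulP-comm h f) (mulP-comm h g) ⟩
    addP (mulP f h) (mulP g h)   ∎
    where open SetoidReasoning ≈-setoid

  mulP-scalePˡ : ∀ c f g → mulP (scaleP c f) g ≈ scaleP c (mulP f g)
  mulP-scalePˡ c []      g = ≈-refl
  mulP-scalePˡ c (a ∷ f) g = begin
    addP (scaleP (c * a) g) (0# ∷ mulP (scaleP c f) g)
      ≈⟨ addP-cong (≈-sym (scaleP-scaleP c a g)) (∷-cong (sym (zeroʳ c)) (mulP-scalePˡ c f g)) ⟩
    addP (scaleP c (scaleP a g)) (scaleP c (0# ∷ mulP f g))
      ≈⟨ scaleP-addP c (scaleP a g) _ ⟨
    scaleP c (addP (scaleP a g) (0# ∷ mulP f g))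
      ∎
    where open SetoidReasoning ≈-setoid

  mulP-assoc : ∀ f g h → mulP (mulP f g) h ≈ mulP f (mulP g h)
  mulP-assoc []      g h = ≈-refl
  mulP-assoc (a ∷ f) g h = begin
    mulP (addP (scaleP a g) (0# ∷ mulP f g)) h
      ≈⟨ mulP-distribʳ (scaleP a g) _ h ⟩
    addP (mulP (scaleP a g) h) (mulP (0# ∷ mulP f g) h)
      ≈⟨ addP-cong (mulP-scalePˡ a g h) (≈-trans (mulP-0∷ (mulP f g) h) (∷-cong refl (mulP-assoc f g h))) ⟩
    addP (scaleP a (mulP g h)) (0# ∷ mulP f (mulP g h))
      ∎
    where open SetoidReasoning ≈-setoid

  mulP-regroup : ∀ a b c d → mulP (mulP a (mulP b c)) d ≈ mulP (mulP a c) (mulP b d)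
  mulP-regroup a b c d = begin
    mulP (mulP a (mulP b c)) d   ≈⟨ mulP-assoc a (mulP b c) d ⟩
    mulP a (mulP (mulP b c) d)   ≈⟨ mulP-congʳ a (mulP-congˡ d (mulP-comm b c)) ⟩
    mulP a (mulP (mulP c b) d)   ≈⟨ mulP-congʳ a (mulP-assoc c b d) ⟩
    mulP a (mulP c (mulP b d))   ≈⟨ mulP-assoc a c (mulP b d) ⟨
    mulP (mulP a c) (mulP b d)   ∎
    where open SetoidReasoning ≈-setoid

  mulP-shiftˡ : ∀ k f g → mulP (shift k f) g ≈ shift k (mulP f g)
  mulP-shiftˡ zero    f g = ≈-refl
  mulP-shiftˡ (suc k) f g = ≈-trans (mulP-0∷ (shift k f) g) (∷-cong refl (mulP-shiftˡ k f g))

  mulP-monomialˡ : ∀ c k g → mulP (monomial c k) g ≈ shift k (scaleP c g)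
  mulP-monomialˡ c k g = ≈-trans (mulP-shiftˡ k [ c ] g) (shift-cong k (mulP-singleton c g))

  coeff-mulP-∷ : ∀ a f g i → coeff (mulP (a ∷ f) g) i ≡ a * coeff g i + coeff (0# ∷ mulP f g) i
  coeff-mulP-∷ a f g i = trans (coeff-addP (scaleP a g) (0# ∷ mulP f g) i) (cong (_+ _) (coeff-scaleP a g i))

  DegreeBelow : ℕ → List A → Set
  DegreeBelow n f = ∀ {i} → n ≤ i → coeff f i ≡ 0#

  record Monic (n : ℕ) (f : List A) : Set where
    constructor monic
    field
      leading : coeff f n ≡ 1#
      above   : DegreeBelow (suc n) f
  open Monic public

  monic-cong : ∀ {n f g} → f ≈ g → Monic n f → Monic n g
  monic-cong f≈g (monic top below) = monic (trans (sym (at f≈g _)) top) (λ le → trans (sym (at f≈g _)) (below le))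

  degreeBelow-1⇒tail-zero : ∀ {a f} → DegreeBelow 1 (a ∷ f) → f ≈ []
  degreeBelow-1⇒tail-zero below = coeffwise λ i → below (s≤s z≤n)

  mulP-degreeBelow : ∀ m n f g → DegreeBelow (suc m) f → DegreeBelow n g → DegreeBelow (m ℕ.+ n) (mulP f g)
  mulP-degreeBelow m       n []      g df dg _ = refl
  mulP-degreeBelow zero    n (a ∷ f) g df dg {i} n≤i = begin
    coeff (mulP (a ∷ f) g) i               ≡⟨ coeff-mulP-∷ a f g i ⟩
    a * coeff g i + coeff (0# ∷ mulP f g) i ≡⟨ cong₂ _+_ (cong (a *_) (dg n≤i)) (at (0∷-zero (mulP-zeroˡ g (degreeBelow-1⇒tail-zero df))) i) ⟩
    a * 0# + 0#                            ≡⟨ trans (+-identityʳ _) (zeroʳ a) ⟩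
    0#                                     ∎
    where open ≡-Reasoning
  mulP-degreeBelow (suc m) n (a ∷ f) g df dg {suc i} (s≤s m+n≤i) = begin
    coeff (mulP (a ∷ f) g) (suc i)           ≡⟨ coeff-mulP-∷ a f g (suc i) ⟩
    a * coeff g (suc i) + coeff (mulP f g) i ≡⟨ cong₂ _+_ (cong (a *_) (dg (ℕP.m≤n⇒m≤1+n (ℕP.m+n≤o⇒n≤o m m+n≤i))))
                                                          (mulP-degreeBelow m n f g (λ le → df (s≤s le)) dg m+n≤i) ⟩
    a * 0# + 0#                              ≡⟨ trans (+-identityʳ _) (zeroʳ a) ⟩
    0#                                       ∎
    where open ≡-Reasoning

  coeff-mulP-leading : ∀ m n f g → DegreeBelow (suc m) f → DegreeBelow (suc n) g →
                   coeff (mulP f g) (m ℕ.+ n) ≡ coeff f m * coeff g n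
  coeff-mulP-leading m       n []      g df dg = sym (zeroˡ _)
  coeff-mulP-leading zero    n (a ∷ f) g df dg = begin
    coeff (mulP (a ∷ f) g) n                ≡⟨ coeff-mulP-∷ a f g n ⟩
    a * coeff g n + coeff (0# ∷ mulP f g) n ≡⟨ cong (_ +_) (at (0∷-zero (mulP-zeroˡ g (degreeBelow-1⇒tail-zero df))) n) ⟩
    a * coeff g n + 0#                      ≡⟨ +-identityʳ _ ⟩
    a * coeff g n                           ∎
    where open ≡-Reasoning
  coeff-mulP-leading (suc m) n (a ∷ f) g df dg = begin
    coeff (mulP (a ∷ f) g) (suc (m ℕ.+ n))             ≡⟨ coeff-mulP-∷ a f g (suc (m ℕ.+ n)) ⟩
    a * coeff g (suc (m ℕ.+ n)) + coeff (mulP f g) (m ℕ.+ n)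
      ≡⟨ cong₂ _+_ (cong (a *_) (dg (s≤s (ℕP.m≤n+m n m))))
                   (coeff-mulP-leading m n f g (λ le → df (s≤s le)) dg) ⟩
    a * 0# + coeff f m * coeff g n                     ≡⟨ trans (cong (_+ coeff f m * coeff g n) (zeroʳ a)) (+-identityˡ _) ⟩
    coeff f m * coeff g n                              ∎
    where open ≡-Reasoning

  monic-mulP : ∀ {m n f g} → Monic m f → Monic n g → Monic (m ℕ.+ n) (mulP f g)
  monic-mulP {m} {n} {f} {g} (monic topf belowf) (monic topg belowg) = monic
    (trans (coeff-mulP-leading m n f g belowf belowg) (trans (cong₂ _*_ topf topg) (*-identityˡ 1#)))
    λ {i} le → mulP-degreeBelow m (suc n) f g belowf belowg (subst (ℕ._≤ i) (sym (ℕP.+-suc m n)) le)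

  coeff-monomial : ∀ c k → coeff (monomial c k) k ≡ c
  coeff-monomial c k = trans (cong (coeff (monomial c k)) (sym (ℕP.+-identityʳ k))) (coeff-shift-+ k [ c ] 0)

  scaleP-shift : ∀ c k f → scaleP c (shift k f) ≈ shift k (scaleP c f)
  scaleP-shift c zero    f = ≈-refl
  scaleP-shift c (suc k) f = ∷-cong (zeroʳ c) (scaleP-shift c k f)

  mulP-monomial : ∀ a m b n → mulP (monomial a m) (monomial b n) ≈ monomial (a * b) (m ℕ.+ n)
  mulP-monomial a m b n = begin
    mulP (monomial a m) (monomial b n)      ≈⟨ mulP-monomialˡ a m (monomial b n) ⟩
    shift m (scaleP a (shift n [ b ]))      ≈⟨ shift-cong m (scaleP-shift a n [ b ]) ⟩
    shift m (shift n [ a * b ])             ≡⟨ shift-+ m n [ a * b ] ⟨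
    monomial (a * b) (m ℕ.+ n)              ∎
    where open SetoidReasoning ≈-setoid

  1^n≡1 : ∀ n → 1# ^ n ≡ 1#
  1^n≡1 zero    = refl
  1^n≡1 (suc n) = trans (*-identityˡ _) (1^n≡1 n)

  geometric : A → ℕ → List A
  geometric σ zero    = []
  geometric σ (suc n) = 1# ∷ scaleP σ (geometric σ n)

  length-geometric : ∀ σ n → length (geometric σ n) ≡ n
  length-geometric σ zero    = refl
  length-geometric σ (suc n) = cong suc (trans (length-map (σ *_) (geometric σ n)) (length-geometric σ n))

  coeff-geometric : ∀ σ {n i} → i < n → coeff (geometric σ n) i ≡ σ ^ i
  coeff-geometric σ {suc n} {zero}  _         = refl
  coeff-geometric σ {suc n} {suc i} (s≤s i<n) =
    trans (coeff-scaleP σ (geometric σ n) i) (cong (σ *_) (coeff-geometric σ i<n))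

  coeff-geometric-≥ : ∀ σ {n i} → n ≤ i → coeff (geometric σ n) i ≡ 0#
  coeff-geometric-≥ σ {n} n≤i = coeff-≥length (geometric σ n) (subst (_≤ _) (sym (length-geometric σ n)) n≤i)

  monic-geometric-1 : ∀ n → Monic n (geometric 1# (suc n))
  monic-geometric-1 n = monic (trans (coeff-geometric 1# (ℕP.n<1+n n)) (1^n≡1 n)) (coeff-geometric-≥ 1#)

  geometric-telescope : ∀ σ n →
    mulP (- 1# ∷ [ σ ]) (geometric σ (suc n)) ≈ addP (monomial (σ ^ suc n) (suc n)) [ - 1# ]
  geometric-telescope σ n = coeffwise λ where
      zero    → trans (coeff-mulP-∷ (- 1#) [ σ ] G 0) (trans (+-identityʳ _) (trans (*-identityʳ _) (sym (+-identityˡ _))))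
      (suc j) → begin
        coeff (mulP (- 1# ∷ [ σ ]) G) (suc j)               ≡⟨ coeff-mulP-∷ (- 1#) [ σ ] G (suc j) ⟩
        - 1# * coeff G (suc j) + coeff (mulP [ σ ] G) j
          ≡⟨ cong₂ _+_ (cong (- 1# *_) (coeff-scaleP σ G′ j)) (trans (at (mulP-singleton σ G) j) (coeff-scaleP σ G j)) ⟩
        - 1# * (σ * coeff G′ j) + σ * coeff G j             ≡⟨ telescoped j ⟩
        coeff (monomial (σ ^ suc n) n) j                    ≡⟨ cong (λ f → coeff f j) (addP-identityʳ (monomial (σ ^ suc n) n)) ⟨
        coeff (addP (monomial (σ ^ suc n) n) []) j          ∎
    where
    open ≡-Reasoning
    G′ = geometric σ n
    G  = geometric σ (suc n)
    cancel : ∀ x → - 1# * x + x ≡ 0#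
    cancel x = trans (cong (_+ x) (-1*x≈-x x)) (-‿inverseˡ x)
    telescoped : ∀ j → - 1# * (σ * coeff G′ j) + σ * coeff G j ≡ coeff (monomial (σ ^ suc n) n) j
    telescoped j with ℕ.<-cmp j n
    ... | tri< j<n _ _ = begin
      - 1# * (σ * coeff G′ j) + σ * coeff G j
        ≡⟨ cong₂ (λ u v → - 1# * (σ * u) + σ * v) (coeff-geometric σ j<n) (coeff-geometric σ (ℕP.m<n⇒m<1+n j<n)) ⟩
      - 1# * (σ * σ ^ j) + σ * σ ^ j                   ≡⟨ cancel _ ⟩
      0#                                               ≡⟨ coeff-shift-< n [ σ ^ suc n ] j<n ⟨
      coeff (monomial (σ ^ suc n) n) j                 ∎
    ... | tri≈ _ refl _ = begin
      - 1# * (σ * coeff G′ j) + σ * coeff G j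
        ≡⟨ cong₂ (λ u v → - 1# * (σ * u) + σ * v) (coeff-geometric-≥ σ {j} ℕP.≤-refl) (coeff-geometric σ (ℕP.n<1+n j)) ⟩
      - 1# * (σ * 0#) + σ * σ ^ j
        ≡⟨ trans (cong (λ u → - 1# * u + σ * σ ^ j) (zeroʳ σ)) (trans (cong (_+ σ * σ ^ j) (zeroʳ (- 1#))) (+-identityˡ _)) ⟩
      σ ^ suc j                                        ≡⟨ coeff-monomial (σ ^ suc j) j ⟨
      coeff (monomial (σ ^ suc n) n) j                 ∎
    ... | tri> _ _ n<j = begin
      - 1# * (σ * coeff G′ j) + σ * coeff G j
        ≡⟨ cong₂ (λ u v → - 1# * (σ * u) + σ * v) (coeff-geometric-≥ σ (ℕP.<⇒≤ n<j)) (coeff-geometric-≥ σ n<j) ⟩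
      - 1# * (σ * 0#) + σ * 0#                         ≡⟨ trans (cong₂ (λ u v → - 1# * u + v) (zeroʳ σ) (zeroʳ σ)) (cancel 0#) ⟩
      0#                                               ≡⟨ coeff-≥length (monomial (σ ^ suc n) n) (subst (_≤ j) (sym (length-monomial n)) n<j) ⟨
      coeff (monomial (σ ^ suc n) n) j                 ∎
      where
      length-monomial : ∀ k → length (monomial (σ ^ suc n) k) ≡ suc k
      length-monomial zero    = refl
      length-monomial (suc k) = cong suc (length-monomial k)

  mulP-identityʳ : ∀ f → mulP f [ 1# ] ≈ f
  mulP-identityʳ f = ≈-trans (mulP-comm f [ 1# ]) (mulP-identityˡ f)

  addP-cancel : ∀ f g h → addP (addP f g) (addP (scaleP (- 1#) g) h) ≈ addP f h
  addP-cancel f g h = coeffwise λ i → begin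
    coeff (addP (addP f g) (addP (scaleP (- 1#) g) h)) i
      ≡⟨ trans (coeff-addP (addP f g) _ i) (cong₂ _+_ (coeff-addP f g i) (coeff-addP (scaleP (- 1#) g) h i)) ⟩
    (coeff f i + coeff g i) + (coeff (scaleP (- 1#) g) i + coeff h i)
      ≡⟨ cong (λ x → (coeff f i + coeff g i) + (x + coeff h i)) (trans (coeff-scaleP (- 1#) g i) (-1*x≈-x _)) ⟩
    (coeff f i + coeff g i) + (- coeff g i + coeff h i)
      ≡⟨ +-assoc (coeff f i) (coeff g i) _ ⟩
    coeff f i + (coeff g i + (- coeff g i + coeff h i))
      ≡⟨ cong (coeff f i +_) (trans (sym (+-assoc (coeff g i) _ _)) (trans (cong (_+ coeff h i) (-‿inverseʳ _)) (+-identityˡ _))) ⟩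
    coeff f i + coeff h i
      ≡⟨ coeff-addP f h i ⟨
    coeff (addP f h) i
      ∎
    where open ≡-Reasoning

  difference-of-squares : ∀ n →
    mulP (addP (monomial 1# n) [ - 1# ]) (addP (monomial 1# n) [ 1# ]) ≈ addP (monomial 1# (n ℕ.+ n)) [ - 1# ]
  difference-of-squares n = begin
    mulP (addP M [ - 1# ]) (addP M [ 1# ])
      ≈⟨ mulP-distribʳ M [ - 1# ] (addP M [ 1# ]) ⟩
    addP (mulP M (addP M [ 1# ])) (mulP [ - 1# ] (addP M [ 1# ]))
      ≈⟨ addP-cong (≈-trans (mulP-distribˡ M M [ 1# ]) (addP-cong (mulP-monomial 1# n 1# n) (mulP-identityʳ M)))
                   (≈-trans (mulP-singleton (- 1#) (addP M [ 1# ])) (scaleP-addP (- 1#) M [ 1# ])) ⟩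
    addP (addP (monomial (1# * 1#) (n ℕ.+ n)) M) (addP (scaleP (- 1#) M) [ - 1# * 1# ])
      ≈⟨ addP-cancel (monomial (1# * 1#) (n ℕ.+ n)) M [ - 1# * 1# ] ⟩
    addP (monomial (1# * 1#) (n ℕ.+ n)) [ - 1# * 1# ]
      ≡⟨ cong₂ (λ a b → addP (monomial a (n ℕ.+ n)) [ b ]) (*-identityˡ 1#) (*-identityʳ (- 1#)) ⟩
    addP (monomial 1# (n ℕ.+ n)) [ - 1# ]
      ∎
    where
    open SetoidReasoning ≈-setoid
    M = monomial 1# n

  monomial-zero : ∀ k → monomial 0# k ≈ []
  monomial-zero zero    = 0∷-zero ≈-refl
  monomial-zero (suc k) = 0∷-zero (monomial-zero k)

  ∷ʳ-monomial : ∀ f x → (f ∷ʳ x) ≈ addP f (monomial x (length f))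
  ∷ʳ-monomial []      x = ≈-refl
  ∷ʳ-monomial (a ∷ f) x = ∷-cong (sym (+-identityʳ a)) (∷ʳ-monomial f x)

  addP-neg-cancel : ∀ f g → addP (addP f g) (map -_ g) ≈ f
  addP-neg-cancel f g = coeffwise λ i → begin
    coeff (addP (addP f g) (map -_ g)) i      ≡⟨ trans (coeff-addP (addP f g) _ i) (cong₂ _+_ (coeff-addP f g i) (coeff-neg g i)) ⟩
    (coeff f i + coeff g i) + - coeff g i     ≡⟨ +-assoc (coeff f i) _ _ ⟩
    coeff f i + (coeff g i + - coeff g i)     ≡⟨ cong (coeff f i +_) (-‿inverseʳ _) ⟩
    coeff f i + 0#                            ≡⟨ +-identityʳ _ ⟩
    coeff f i                                 ∎
    where open ≡-Reasoning

  monomials : List (A × ℕ) → List A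
  monomials []             = []
  monomials ((c , e) ∷ ts) = addP (monomial c e) (monomials ts)

  involution-^ : ∀ {w} → w * w ≡ 1# → ∀ q → w ^ q * w ^ q ≡ 1#
  involution-^ w²≡1 zero    = *-identityˡ 1#
  involution-^ {w} w²≡1 (suc q) = begin
    (w * w ^ q) * (w * w ^ q)  ≡⟨ *-interchange w (w ^ q) w (w ^ q) ⟩
    (w * w) * (w ^ q * w ^ q)  ≡⟨ cong₂ _*_ w²≡1 (involution-^ w²≡1 q) ⟩
    1# * 1#                    ≡⟨ *-identityˡ 1# ⟩
    1#                         ∎
    where open ≡-Reasoning

  involution-^-even : ∀ {w} → w * w ≡ 1# → ∀ h → w ^ (h ℕ.* 2) ≡ 1#
  involution-^-even w²≡1 zero    = refl
  involution-^-even {w} w²≡1 (suc h) = begin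
    w * (w * w ^ (h ℕ.* 2))  ≡⟨ *-assoc w w _ ⟨
    (w * w) * w ^ (h ℕ.* 2)  ≡⟨ cong₂ _*_ w²≡1 (involution-^-even w²≡1 h) ⟩
    1# * 1#                  ≡⟨ *-identityˡ 1# ⟩
    1#                       ∎
    where open ≡-Reasoning

  involution-*-nonzero : ∀ {w c} → w * w ≡ 1# → c ≢ 0# → w * c ≢ 0#
  involution-*-nonzero {w} {c} w²≡1 c≢0 wc≡0 = c≢0 (begin
    c              ≡⟨ *-identityˡ c ⟨
    1# * c         ≡⟨ cong (_* c) w²≡1 ⟨
    (w * w) * c    ≡⟨ *-assoc w w c ⟩
    w * (w * c)    ≡⟨ cong (w *_) wc≡0 ⟩
    w * 0#         ≡⟨ zeroʳ w ⟩
    0#             ∎)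
    where open ≡-Reasoning

  -1*a+b≡0⇒a≡b : ∀ {a b} → - 1# * a + b ≡ 0# → a ≡ b
  -1*a+b≡0⇒a≡b {a} {b} eq = begin
    a                    ≡⟨ +-identityʳ a ⟨
    a + 0#               ≡⟨ cong (a +_) eq ⟨
    a + (- 1# * a + b)   ≡⟨ cong (λ x → a + (x + b)) (-1*x≈-x a) ⟩
    a + (- a + b)        ≡⟨ +-assoc a (- a) b ⟨
    (a + - a) + b        ≡⟨ cong (_+ b) (-‿inverseʳ a) ⟩
    0# + b               ≡⟨ +-identityˡ b ⟩
    b                    ∎
    where open ≡-Reasoning

  -- Reduction modulo x^(suc p′) - ε

  module Reduction (p′ : ℕ) (ε : A) where

    p : ℕ
    p = suc p′

    -- reduce k f is the coefficient of xᵏ, for k ≤ p′, in the remainder of f modulo xᵖ - ε.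
    reduce : ℕ → List A → A
    reduce k       []      = 0#
    reduce zero    (a ∷ f) = a + ε * reduce p′ f
    reduce (suc k) (a ∷ f) = reduce k f

    reduce-zero : ∀ {f} k → f ≈ [] → reduce k f ≡ 0#
    reduce-zero {[]}    k       f≈0 = refl
    reduce-zero {a ∷ f} zero    f≈0 =
      trans (cong₂ (λ x y → x + ε * y) (at f≈0 0) (reduce-zero p′ (∷-tail-zero f≈0)))
            (trans (+-identityˡ _) (zeroʳ ε))
    reduce-zero {a ∷ f} (suc k) f≈0 = reduce-zero k (∷-tail-zero f≈0)

    reduce-cong : ∀ {f g} k → f ≈ g → reduce k f ≡ reduce k g
    reduce-cong {[]}    {g}     k       f≈g = sym (reduce-zero k (≈-sym f≈g))
    reduce-cong {a ∷ f} {[]}    k       f≈g = reduce-zero k f≈g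
    reduce-cong {a ∷ f} {b ∷ g} zero    f≈g =
      cong₂ (λ x y → x + ε * y) (at f≈g 0) (reduce-cong p′ (∷-tail f≈g))
    reduce-cong {a ∷ f} {b ∷ g} (suc k) f≈g = reduce-cong k (∷-tail f≈g)

    reduce-addP : ∀ k f g → reduce k (addP f g) ≡ reduce k f + reduce k g
    reduce-addP k       []      g       = sym (+-identityˡ _)
    reduce-addP k       (a ∷ f) []      = sym (+-identityʳ _)
    reduce-addP zero    (a ∷ f) (b ∷ g) = begin
      (a + b) + ε * reduce p′ (addP f g)                ≡⟨ cong (λ x → (a + b) + ε * x) (reduce-addP p′ f g) ⟩
      (a + b) + ε * (reduce p′ f + reduce p′ g)         ≡⟨ cong ((a + b) +_) (distribˡ ε _ _) ⟩
      (a + b) + (ε * reduce p′ f + ε * reduce p′ g)     ≡⟨ interchange a b _ _ ⟩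
      (a + ε * reduce p′ f) + (b + ε * reduce p′ g)     ∎
      where open ≡-Reasoning
    reduce-addP (suc k) (a ∷ f) (b ∷ g) = reduce-addP k f g

    reduce-scaleP : ∀ k c f → reduce k (scaleP c f) ≡ c * reduce k f
    reduce-scaleP k       c []      = sym (zeroʳ c)
    reduce-scaleP zero    c (a ∷ f) = begin
      c * a + ε * reduce p′ (scaleP c f)  ≡⟨ cong (λ x → c * a + ε * x) (reduce-scaleP p′ c f) ⟩
      c * a + ε * (c * reduce p′ f)       ≡⟨ cong (c * a +_) (*-x∙yz≈y∙xz ε c _) ⟩
      c * a + c * (ε * reduce p′ f)       ≡⟨ distribˡ c _ _ ⟨
      c * (a + ε * reduce p′ f)           ∎
      where open ≡-Reasoning
    reduce-scaleP (suc k) c (a ∷ f) = reduce-scaleP k c f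

    reduce-mulP-∷ : ∀ k a f g → reduce (suc k) (mulP (a ∷ f) g) ≡ a * reduce (suc k) g + reduce k (mulP f g)
    reduce-mulP-∷ k a f g =
      trans (reduce-addP (suc k) (scaleP a g) (0# ∷ mulP f g)) (cong (_+ reduce k (mulP f g)) (reduce-scaleP (suc k) a g))

    reduce-shift : ∀ j k f → reduce (j ℕ.+ k) (shift j f) ≡ reduce k f
    reduce-shift zero    k f = refl
    reduce-shift (suc j) k f = reduce-shift j k f

    reduce-shift-period : ∀ {k} f → k ≤ p′ → reduce k (shift p f) ≡ ε * reduce k f
    reduce-shift-period {k} f k≤p′ = begin
      reduce k (shift p f)                         ≡⟨ cong (λ n → reduce k (shift n f)) p≡k+1+m ⟩
      reduce k (shift (k ℕ.+ suc m) f)             ≡⟨ cong₂ reduce (sym (ℕP.+-identityʳ k)) (shift-+ k (suc m) f) ⟩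
      reduce (k ℕ.+ 0) (shift k (shift (suc m) f)) ≡⟨ reduce-shift k 0 (shift (suc m) f) ⟩
      0# + ε * reduce p′ (shift m f)               ≡⟨ +-identityˡ _ ⟩
      ε * reduce p′ (shift m f)                    ≡⟨ cong (λ i → ε * reduce i (shift m f)) (ℕP.m∸n+n≡m k≤p′) ⟨
      ε * reduce (m ℕ.+ k) (shift m f)             ≡⟨ cong (ε *_) (reduce-shift m k f) ⟩
      ε * reduce k f                               ∎
      where
      open ≡-Reasoning
      m = p′ ℕ.∸ k
      p≡k+1+m : p ≡ k ℕ.+ suc m
      p≡k+1+m = trans (cong suc (sym (ℕP.m+[n∸m]≡n k≤p′))) (sym (ℕP.+-suc k m))

    reduce-shift-periods : ∀ q {k} f → k ≤ p′ → reduce k (shift (q ℕ.* p) f) ≡ ε ^ q * reduce k f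
    reduce-shift-periods zero    f k≤p′ = sym (*-identityˡ _)
    reduce-shift-periods (suc q) {k} f k≤p′ = begin
      reduce k (shift (p ℕ.+ q ℕ.* p) f)       ≡⟨ cong (reduce k) (shift-+ p (q ℕ.* p) f) ⟩
      reduce k (shift p (shift (q ℕ.* p) f))   ≡⟨ reduce-shift-period (shift (q ℕ.* p) f) k≤p′ ⟩
      ε * reduce k (shift (q ℕ.* p) f)         ≡⟨ cong (ε *_) (reduce-shift-periods q f k≤p′) ⟩
      ε * (ε ^ q * reduce k f)                 ≡⟨ *-assoc ε _ _ ⟨
      ε ^ suc q * reduce k f                   ∎
      where open ≡-Reasoning

    reduce-monomial-≡ : ∀ c r → reduce r (monomial c r) ≡ c
    reduce-monomial-≡ c zero    = trans (cong (c +_) (zeroʳ ε)) (+-identityʳ c)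
    reduce-monomial-≡ c (suc r) = reduce-monomial-≡ c r

    reduce-monomial-≢ : ∀ c {r k} → r ≤ p′ → r ≢ k → reduce k (monomial c r) ≡ 0#
    reduce-monomial-≢ c {zero}  {zero}  _   r≢k = ⊥-elim (r≢k refl)
    reduce-monomial-≢ c {zero}  {suc k} _   _   = refl
    reduce-monomial-≢ c {suc r} {zero}  r<p′ _  = begin
      0# + ε * reduce p′ (monomial c r)  ≡⟨ cong (λ x → 0# + ε * x) (reduce-monomial-≢ c (ℕP.<⇒≤ r<p′) (ℕP.<⇒≢ r<p′)) ⟩
      0# + ε * 0#                        ≡⟨ trans (+-identityˡ _) (zeroʳ ε) ⟩
      0#                                 ∎
      where open ≡-Reasoning
    reduce-monomial-≢ c {suc r} {suc k} r<p′ r≢k = reduce-monomial-≢ c (ℕP.<⇒≤ r<p′) (r≢k ∘ cong suc)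

    monomial-periods : ∀ c e → monomial c e ≡ shift (e / p ℕ.* p) (monomial c (e % p))
    monomial-periods c e = begin
      shift e [ c ]                                 ≡⟨ cong (λ n → shift n [ c ]) (trans (m≡m%n+[m/n]*n e p) (ℕP.+-comm (e % p) _)) ⟩
      shift (e / p ℕ.* p ℕ.+ e % p) [ c ]           ≡⟨ shift-+ (e / p ℕ.* p) (e % p) [ c ] ⟩
      shift (e / p ℕ.* p) (shift (e % p) [ c ])     ∎
      where open ≡-Reasoning

    %p≤p′ : ∀ e → e % p ≤ p′
    %p≤p′ e = ℕP.≤-pred (m%n<n e p)

    reduce-monomial-hit : ∀ c e → reduce (e % p) (monomial c e) ≡ ε ^ (e / p) * c
    reduce-monomial-hit c e = begin
      reduce (e % p) (monomial c e)                                       ≡⟨ cong (reduce (e % p)) (monomial-periods c e) ⟩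
      reduce (e % p) (shift (e / p ℕ.* p) (monomial c (e % p)))           ≡⟨ reduce-shift-periods (e / p) _ (%p≤p′ e) ⟩
      ε ^ (e / p) * reduce (e % p) (monomial c (e % p))                    ≡⟨ cong (ε ^ (e / p) *_) (reduce-monomial-≡ c (e % p)) ⟩
      ε ^ (e / p) * c                                                     ∎
      where open ≡-Reasoning

    reduce-monomial-miss : ∀ c e {k} → k ≤ p′ → e % p ≢ k → reduce k (monomial c e) ≡ 0#
    reduce-monomial-miss c e {k} k≤p′ e%p≢k = begin
      reduce k (monomial c e)                                 ≡⟨ cong (reduce k) (monomial-periods c e) ⟩
      reduce k (shift (e / p ℕ.* p) (monomial c (e % p)))     ≡⟨ reduce-shift-periods (e / p) _ k≤p′ ⟩
      ε ^ (e / p) * reduce k (monomial c (e % p))             ≡⟨ cong (ε ^ (e / p) *_) (reduce-monomial-≢ c (%p≤p′ e) e%p≢k) ⟩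
      ε ^ (e / p) * 0#                                        ≡⟨ zeroʳ _ ⟩
      0#                                                      ∎
      where open ≡-Reasoning

    Misses : ℕ → List (A × ℕ) → Set
    Misses k = All (λ t → proj₂ t % p ≢ k)

    reduce-monomials-miss : ∀ {k ts} → k ≤ p′ → Misses k ts → reduce k (monomials ts) ≡ 0#
    reduce-monomials-miss {k} k≤p′ []                         = refl
    reduce-monomials-miss {k} k≤p′ (_∷_ {c , e} {ts} miss misses) = begin
      reduce k (addP (monomial c e) (monomials ts))         ≡⟨ reduce-addP k (monomial c e) (monomials ts) ⟩
      reduce k (monomial c e) + reduce k (monomials ts)     ≡⟨ cong₂ _+_ (reduce-monomial-miss c e k≤p′ miss) (reduce-monomials-miss k≤p′ misses) ⟩
      0# + 0#                                               ≡⟨ +-identityˡ 0# ⟩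
      0#                                                    ∎
      where open ≡-Reasoning

    reduce-monomials-hit : ∀ ts₁ c e ts₂ → Misses (e % p) ts₁ → Misses (e % p) ts₂ →
                           reduce (e % p) (monomials (ts₁ ++ (c , e) ∷ ts₂)) ≡ ε ^ (e / p) * c
    reduce-monomials-hit [] c e ts₂ [] misses₂ = begin
      reduce (e % p) (addP (monomial c e) (monomials ts₂))              ≡⟨ reduce-addP (e % p) (monomial c e) (monomials ts₂) ⟩
      reduce (e % p) (monomial c e) + reduce (e % p) (monomials ts₂)    ≡⟨ cong₂ _+_ (reduce-monomial-hit c e) (reduce-monomials-miss (%p≤p′ e) misses₂) ⟩
      ε ^ (e / p) * c + 0#                                              ≡⟨ +-identityʳ _ ⟩
      ε ^ (e / p) * c                                                   ∎
      where open ≡-Reasoning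
    reduce-monomials-hit ((c′ , e′) ∷ ts₁) c e ts₂ (miss ∷ misses₁) misses₂ = begin
      reduce (e % p) (addP (monomial c′ e′) (monomials (ts₁ ++ (c , e) ∷ ts₂)))
        ≡⟨ reduce-addP (e % p) (monomial c′ e′) _ ⟩
      reduce (e % p) (monomial c′ e′) + reduce (e % p) (monomials (ts₁ ++ (c , e) ∷ ts₂))
        ≡⟨ cong₂ _+_ (reduce-monomial-miss c′ e′ (%p≤p′ e) miss) (reduce-monomials-hit ts₁ c e ts₂ misses₁ misses₂) ⟩
      0# + ε ^ (e / p) * c
        ≡⟨ +-identityˡ _ ⟩
      ε ^ (e / p) * c
        ∎
      where open ≡-Reasoning

    module Multiples (σ : A) (σ²≡1 : σ * σ ≡ 1#) (σᵖε≡1 : σ ^ p * ε ≡ 1#) where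

      reduce-modulus : ∀ q {k} → k ≤ p′ → reduce k (mulP (addP (monomial (σ ^ p) p) [ - 1# ]) q) ≡ 0#
      reduce-modulus q {k} k≤p′ = begin
        reduce k (mulP (addP (monomial (σ ^ p) p) [ - 1# ]) q)
          ≡⟨ reduce-cong k (≈-trans (mulP-distribʳ (monomial (σ ^ p) p) [ - 1# ] q)
                                    (addP-cong (mulP-monomialˡ (σ ^ p) p q) (mulP-singleton (- 1#) q))) ⟩
        reduce k (addP (shift p (scaleP (σ ^ p) q)) (scaleP (- 1#) q))
          ≡⟨ reduce-addP k (shift p (scaleP (σ ^ p) q)) (scaleP (- 1#) q) ⟩
        reduce k (shift p (scaleP (σ ^ p) q)) + reduce k (scaleP (- 1#) q)
          ≡⟨ cong₂ _+_ (trans (reduce-shift-period (scaleP (σ ^ p) q) k≤p′) (cong (ε *_) (reduce-scaleP k (σ ^ p) q)))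
                       (trans (reduce-scaleP k (- 1#) q) (-1*x≈-x _)) ⟩
        ε * (σ ^ p * r) + - r
          ≡⟨ cong (_+ - r) (trans (*-x∙yz≈y∙xz ε (σ ^ p) r) (trans (sym (*-assoc (σ ^ p) ε r)) (cong (_* r) σᵖε≡1))) ⟩
        1# * r + - r
          ≡⟨ trans (cong (_+ - r) (*-identityˡ r)) (-‿inverseʳ r) ⟩
        0#
          ∎
        where
        open ≡-Reasoning
        r = reduce k q

      reduce-multiple-step : ∀ {V q} → V ≈ mulP (geometric σ p) q → ∀ {k} → k < p′ → reduce (suc k) V ≡ σ * reduce k V
      reduce-multiple-step {V} {q} V≈Gq {k} k<p′ = -1*a+b≡0⇒a≡b (begin
        - 1# * reduce (suc k) V + σ * reduce k V
          ≡⟨ cong (_ +_) (trans (reduce-cong k (mulP-singleton σ V)) (reduce-scaleP k σ V)) ⟨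
        - 1# * reduce (suc k) V + reduce k (mulP [ σ ] V)
          ≡⟨ reduce-mulP-∷ k (- 1#) [ σ ] V ⟨
        reduce (suc k) (mulP (- 1# ∷ [ σ ]) V)
          ≡⟨ reduce-cong (suc k) LV≈Mq ⟩
        reduce (suc k) (mulP (addP (monomial (σ ^ p) p) [ - 1# ]) q)
          ≡⟨ reduce-modulus q k<p′ ⟩
        0#
          ∎)
        where
        open ≡-Reasoning
        LV≈Mq : mulP (- 1# ∷ [ σ ]) V ≈ mulP (addP (monomial (σ ^ p) p) [ - 1# ]) q
        LV≈Mq = begin≈
          mulP (- 1# ∷ [ σ ]) V                             ≈⟨ mulP-congʳ (- 1# ∷ [ σ ]) V≈Gq ⟩
          mulP (- 1# ∷ [ σ ]) (mulP (geometric σ p) q)      ≈⟨ mulP-assoc (- 1# ∷ [ σ ]) (geometric σ p) q ⟨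
          mulP (mulP (- 1# ∷ [ σ ]) (geometric σ p)) q      ≈⟨ mulP-congˡ q (geometric-telescope σ p′) ⟩
          mulP (addP (monomial (σ ^ p) p) [ - 1# ]) q       ∎≈
          where open SetoidReasoning ≈-setoid renaming (begin_ to begin≈_; _∎ to _∎≈)

      reduce-multiple-zero-up : ∀ {V q} → V ≈ mulP (geometric σ p) q → ∀ {k} → k < p′ → reduce k V ≡ 0# → reduce (suc k) V ≡ 0#
      reduce-multiple-zero-up V≈Gq k<p′ vanishes = trans (reduce-multiple-step V≈Gq k<p′) (trans (cong (σ *_) vanishes) (zeroʳ σ))

      reduce-multiple-zero-down : ∀ {V q} → V ≈ mulP (geometric σ p) q → ∀ {k} → k < p′ → reduce (suc k) V ≡ 0# → reduce k V ≡ 0#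
      reduce-multiple-zero-down {V} V≈Gq {k} k<p′ vanishes = begin
        reduce k V                ≡⟨ *-identityˡ _ ⟨
        1# * reduce k V           ≡⟨ cong (_* reduce k V) σ²≡1 ⟨
        (σ * σ) * reduce k V      ≡⟨ *-assoc σ σ _ ⟩
        σ * (σ * reduce k V)      ≡⟨ cong (σ *_) (reduce-multiple-step V≈Gq k<p′) ⟨
        σ * reduce (suc k) V      ≡⟨ trans (cong (σ *_) vanishes) (zeroʳ σ) ⟩
        0#                        ∎
        where open ≡-Reasoning

      reduce-multiple-zero : ∀ {V q} → V ≈ mulP (geometric σ p) q → ∀ {k₁ k₂} → k₁ ≤ p′ → k₂ ≤ p′ →
                             reduce k₁ V ≡ 0# → reduce k₂ V ≡ 0#
      reduce-multiple-zero {V} V≈Gq {k₁} {k₂} k₁≤p′ k₂≤p′ vanishes = from-0 k₂≤p′ (to-0 k₁≤p′ vanishes)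
        where
        to-0 : ∀ {k} → k ≤ p′ → reduce k V ≡ 0# → reduce 0 V ≡ 0#
        to-0 {zero}  _    z = z
        to-0 {suc k} k<p′ z = to-0 (ℕP.<⇒≤ k<p′) (reduce-multiple-zero-down V≈Gq k<p′ z)
        from-0 : ∀ {k} → k ≤ p′ → reduce 0 V ≡ 0# → reduce k V ≡ 0#
        from-0 {zero}  _    z = z
        from-0 {suc k} k<p′ z = reduce-multiple-zero-up V≈Gq k<p′ (from-0 (ℕP.<⇒≤ k<p′) z)

open import Data.Integer using (+_; -[1+_])

module ℤ[x] = RingPolynomials ℤP.+-*-isCommutativeRing

module LongDivision where

  open ℤ[x] using (_≈_; coeffwise; at; ≈-refl; ≈-sym; ≈-trans; ≈-setoid; ∷-cong; ∷-tail; ∷-tail-zero; degreeBelow-1⇒tail-zero;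
                   DegreeBelow; Monic; monic; leading; above; monic-cong; coeff-≥length; coeff-mulP-leading; mulP-degreeBelow;
                   addP-cong; addP-comm; mulP-congʳ; mulP-congˡ; mulP-comm; mulP-distribˡ; mulP-zeroʳ;
                   ∷ʳ-monomial; monomial-zero; neg-cong; ≈-reflexive; addP-neg-cancel; addP-identityʳ)
  open ZP using (coeff; addP; mulP; monomial)

  coeff-trim : ∀ f → trim f ≈ f
  coeff-trim []      = ≈-refl
  coeff-trim (a ∷ f) with trim f | coeff-trim f
  ... | []    | f≈ with a ℤ.≟ + 0
  ...   | yes a≡0 = coeffwise λ { zero → sym a≡0 ; (suc i) → at f≈ i }
  ...   | no  _   = ∷-cong refl f≈
  coeff-trim (a ∷ f) | b ∷ g | f≈ = ∷-cong refl f≈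

  trim-zero : ∀ f → f ≈ [] → trim f ≡ []
  trim-zero []      _   = refl
  trim-zero (a ∷ f) f≈0 with trim f | trim-zero f (∷-tail-zero f≈0)
  ... | [] | refl rewrite at f≈0 0 = refl

  trim-cong : ∀ f g → f ≈ g → trim f ≡ trim g
  trim-cong []      g       f≈g = sym (trim-zero g (≈-sym f≈g))
  trim-cong (a ∷ f) []      f≈g = trim-zero (a ∷ f) f≈g
  trim-cong (a ∷ f) (b ∷ g) f≈g with at f≈g 0 | trim f | trim g | trim-cong f g (∷-tail f≈g)
  ... | refl | tf | .tf | refl = refl

  trim-top : ∀ f n → coeff f n ≢ + 0 → DegreeBelow (suc n) f →
             length (trim f) ≡ suc n × lastOr (+ 0) (trim f) ≡ coeff f n
  trim-top []      n       top≢0 _     = ⊥-elim (top≢0 refl)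
  trim-top (a ∷ f) zero    top≢0 below with trim f | trim-zero f (degreeBelow-1⇒tail-zero below)
  ... | [] | refl with a ℤ.≟ + 0
  ...   | yes a≡0 = ⊥-elim (top≢0 a≡0)
  ...   | no  _   = refl , refl
  trim-top (a ∷ f) (suc n) top≢0 below with trim f | trim-top f n top≢0 (λ le → below (s≤s le))
  ... | b ∷ g | length≡ , last≡ = cong suc length≡ , last≡

  trim-monic : ∀ {m b} → Monic m b → length (trim b) ≡ suc m
  trim-monic {m} {b} (monic top below) with trim-top b m (λ top≡0 → 1≢0 (trans (sym top) top≡0)) below
    where
    1≢0 : + 1 ≢ + 0
    1≢0 ()
  ... | length≡ , _ = length≡

  +-<ᵇ-false : ∀ m n → (m ℕ.+ n ℕ.<ᵇ n) ≡ false
  +-<ᵇ-false m n with m ℕ.+ n ℕ.<ᵇ n in eq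
  ... | false = refl
  ... | true  = ⊥-elim (ℕP.<⇒≱ (ℕP.<ᵇ⇒< (m ℕ.+ n) n (subst T (sym eq) _)) (ℕP.m≤n+m n m))

  quotMonic-[] : ∀ f a b {m} → trim a ≡ [] → length (trim b) ≡ suc m → quotMonic f a b ≡ []
  quotMonic-[] zero    a b _      _        = refl
  quotMonic-[] (suc f) a b trim-a length-b rewrite trim-a | length-b = refl

  quotMonic-step : ∀ f a b k x → length (trim a) ≡ k ℕ.+ length (trim b) → lastOr (+ 0) (trim a) ≡ x →
    quotMonic (suc f) a b ≡ addP (monomial x k) (quotMonic f (trim (addP (trim a) (negᶻ (mulP (monomial x k) (trim b))))) (trim b))
  quotMonic-step f a b k x length≡ last≡
    rewrite length≡ | last≡ | +-<ᵇ-false k (length (trim b)) | ℕP.m+n∸n≡m k (length (trim b)) = refl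

  length-∷ʳ : ∀ (xs : List ℤ) x → length (xs ∷ʳ x) ≡ suc (length xs)
  length-∷ʳ xs x = trans (length-++ xs) (ℕP.+-comm (length xs) 1)

  coeff-∷ʳ-length : ∀ xs x → coeff (xs ∷ʳ x) (length xs) ≡ x
  coeff-∷ʳ-length []       x = refl
  coeff-∷ʳ-length (_ ∷ xs) x = coeff-∷ʳ-length xs x

  module _ {m b} (monic′ : Monic m b) {init x a} (a≈b·c : a ≈ mulP b (init ∷ʳ x)) where

    private
      k = length init
      c = init ∷ʳ x
      below-c : DegreeBelow (suc k) c
      below-c {i} le = coeff-≥length c (subst (_≤ i) (sym (length-∷ʳ init x)) le)
      top-a : coeff a (m ℕ.+ k) ≡ x
      top-a = begin
        coeff a (m ℕ.+ k)                ≡⟨ at a≈b·c (m ℕ.+ k) ⟩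
        coeff (mulP b c) (m ℕ.+ k)       ≡⟨ coeff-mulP-leading m k b c (above monic′) below-c ⟩
        coeff b m ℤ.* coeff c k          ≡⟨ cong₂ ℤ._*_ (leading monic′) (coeff-∷ʳ-length init x) ⟩
        + 1 ℤ.* x                        ≡⟨ ℤP.*-identityˡ x ⟩
        x                                ∎
        where open ≡-Reasoning
      below-a : DegreeBelow (suc (m ℕ.+ k)) a
      below-a {i} le = trans (at a≈b·c i) (mulP-degreeBelow m (suc k) b c (above monic′) below-c (subst (_≤ i) (sym (ℕP.+-suc m k)) le))

    division-remainder : addP (trim a) (negᶻ (mulP (monomial x k) (trim b))) ≈ mulP b init
    division-remainder = begin
      addP (trim a) (negᶻ (mulP (monomial x k) (trim b)))
        ≈⟨ addP-cong (≈-trans (coeff-trim a) a≈b·c) (neg-cong (≈-trans (mulP-congʳ (monomial x k) (coeff-trim b)) (mulP-comm (monomial x k) b))) ⟩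
      addP (mulP b (init ∷ʳ x)) (negᶻ (mulP b (monomial x k)))
        ≈⟨ addP-cong (≈-trans (mulP-congʳ b (∷ʳ-monomial init x)) (mulP-distribˡ b init (monomial x k))) ≈-refl ⟩
      addP (addP (mulP b init) (mulP b (monomial x k))) (negᶻ (mulP b (monomial x k)))
        ≈⟨ addP-neg-cancel (mulP b init) (mulP b (monomial x k)) ⟩
      mulP b init
        ∎
      where open SetoidReasoning ≈-setoid

    division-leading : x ≢ + 0 → length (trim a) ≡ k ℕ.+ length (trim b) × lastOr (+ 0) (trim a) ≡ x
    division-leading x≢0 with trim-top a (m ℕ.+ k) (x≢0 ∘ trans (sym top-a)) below-a
    ... | length≡ , last≡ =
      trans length≡ (trans (cong suc (ℕP.+-comm m k)) (trans (sym (ℕP.+-suc k m)) (cong (k ℕ.+_) (sym (trim-monic monic′))))) ,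
      trans last≡ top-a

  quotMonic-exact : ∀ {m b} → Monic m b → ∀ {c} → Reverse c → ∀ f a → length c ≤ f → a ≈ mulP b c → quotMonic f a b ≈ c
  quotMonic-exact {b = b} b-monic [] f a _ a≈b·0 =
    ≈-reflexive (quotMonic-[] f a b (trim-zero a (≈-trans a≈b·0 (mulP-zeroʳ b))) (trim-monic b-monic))
  quotMonic-exact {b = b} b-monic (init ∶ rs ∶ʳ x) f a length≤f a≈b·c with x ℤ.≟ + 0
  ... | yes refl = ≈-trans (quotMonic-exact b-monic rs f a length-init≤f (≈-trans a≈b·c (mulP-congʳ b c≈init))) (≈-sym c≈init)
    where
    c≈init : (init ∷ʳ + 0) ≈ init
    c≈init = ≈-trans (∷ʳ-monomial init (+ 0)) (≈-trans (addP-cong ≈-refl (monomial-zero _)) (≈-reflexive (addP-identityʳ init)))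
    length-init≤f : length init ≤ f
    length-init≤f = ℕP.≤-trans (ℕP.n≤1+n _) (subst (_≤ f) (length-∷ʳ init (+ 0)) length≤f)
  quotMonic-exact {b = b} b-monic (init ∶ rs ∶ʳ x) zero a length≤0 a≈b·c | no x≢0 =
    ⊥-elim (1+n≰0 (subst (_≤ 0) (length-∷ʳ init x) length≤0))
    where
    1+n≰0 : ∀ {n} → ¬ suc n ≤ 0
    1+n≰0 ()
  quotMonic-exact {b = b} b-monic (init ∶ rs ∶ʳ x) (suc f) a length≤f a≈b·c | no x≢0 = begin
    quotMonic (suc f) a b
      ≡⟨ quotMonic-step f a b k x length≡ last≡ ⟩
    addP (monomial x k) (quotMonic f (trim remainder) (trim b))
      ≈⟨ addP-cong ≈-refl (quotMonic-exact (monic-cong (≈-sym (coeff-trim b)) b-monic) rs f (trim remainder) length-init≤f remainder≈) ⟩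
    addP (monomial x k) init
      ≈⟨ addP-comm (monomial x k) init ⟩
    addP init (monomial x k)
      ≈⟨ ∷ʳ-monomial init x ⟨
    init ∷ʳ x
      ∎
    where
    open SetoidReasoning ≈-setoid
    k = length init
    remainder = addP (trim a) (negᶻ (mulP (monomial x k) (trim b)))
    remainder≈ : trim remainder ≈ mulP (trim b) init
    remainder≈ = ≈-trans (coeff-trim remainder) (≈-trans (division-remainder b-monic a≈b·c) (mulP-congˡ init (≈-sym (coeff-trim b))))
    length-init≤f : length init ≤ f
    length-init≤f = ℕP.≤-pred (subst (_≤ suc f) (length-∷ʳ init x) length≤f)
    length≡ = proj₁ (division-leading b-monic a≈b·c x≢0)
    last≡ = proj₂ (division-leading b-monic a≈b·c x≢0)

module CyclotomicValues where

  open ℤ[x] using (_≈_; ≈-refl; ≈-sym; ≈-trans; ≈-reflexive; ≈-setoid; Monic; monic; monic-cong; monic-mulP; monic-geometric-1;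
                   coeff-≥length; mulP-congˡ; mulP-congʳ; mulP-identityˡ; mulP-identityʳ; mulP-scalePˡ; mulP-regroup;
                   addP-cong; scaleP-cong; scaleP-addP; scaleP-shift; geometric; length-geometric; geometric-telescope;
                   difference-of-squares; 1^n≡1; involution-^-even; _^_)
  open ZP using (coeff; addP; scaleP; mulP; monomial)
  open LongDivision

  twice-prime-divisor : ∀ {p d} → Prime p → d ∣ 2 ℕ.* p → d ≡ 1 ⊎ d ≡ 2 ⊎ d ≡ p ⊎ d ≡ 2 ℕ.* p
  twice-prime-divisor {p} {d} pr d∣2p with p ∣? d
  ... | yes (divides q refl) with irreducible[2] (*-cancelʳ-∣ {q} {2} p {{prime⇒nonZero pr}} d∣2p)
  ...   | inj₁ refl = inj₂ (inj₂ (inj₁ (ℕP.*-identityˡ p)))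
  ...   | inj₂ refl = inj₂ (inj₂ (inj₂ refl))
  twice-prime-divisor {p} {d} pr d∣2p | no p∤d with irreducible[2] (coprime-divisor d⊥p (subst (d ∣_) (ℕP.*-comm 2 p) d∣2p))
    where
    d⊥p : Coprime d p
    d⊥p (i∣d , i∣p) with prime⇒irreducible pr i∣p
    ... | inj₁ i≡1 = i≡1
    ... | inj₂ refl = ⊥-elim (p∤d i∣d)
  ... | inj₁ d≡1 = inj₁ d≡1
  ... | inj₂ d≡2 = inj₂ (inj₁ d≡2)

  ∤-twice-prime : ∀ {p d} → Prime p → 3 ≤ d → d < 2 ℕ.* p → d ≢ p → ¬ d ∣ 2 ℕ.* p
  ∤-twice-prime pr 3≤d d<2p d≢p d∣2p with twice-prime-divisor pr d∣2p
  ... | inj₁ refl                  = ℕP.<⇒≱ 3≤d (s≤s z≤n)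
  ... | inj₂ (inj₁ refl)           = ℕP.<⇒≱ 3≤d (s≤s (s≤s z≤n))
  ... | inj₂ (inj₂ (inj₁ d≡p))     = d≢p d≡p
  ... | inj₂ (inj₂ (inj₂ refl))    = ℕP.<-irrefl refl d<2p

  odd-prime : ∀ {p} → Prime p → p ≢ 2 → p ≡ suc (p / 2 ℕ.* 2)
  odd-prime {p} pr p≢2 with p % 2 in p%2≡ | m%n<n p 2
  ... | 0 | _ with prime⇒irreducible pr (m%n≡0⇒n∣m p 2 p%2≡)
  ...   | inj₂ 2≡p = ⊥-elim (p≢2 (sym 2≡p))
  odd-prime {p} pr p≢2 | 1 | _ = trans (m≡m%n+[m/n]*n p 2) (cong (ℕ._+ (p / 2 ℕ.* 2)) p%2≡)
  odd-prime {p} pr p≢2 | suc (suc _) | s≤s (s≤s ())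

  lastOr-∷ʳ : ∀ {A : Set} (d : A) xs x → lastOr d (xs ∷ʳ x) ≡ x
  lastOr-∷ʳ d []       x = refl
  lastOr-∷ʳ d (y ∷ xs) x = lastOr-∷ʳ y xs x

  Φ-suc : ∀ n → Φ (suc n) ≡ trim (quotMonic (suc (suc n)) (xnm1 (suc n)) (prodDivisors (suc n) 1 (cycTable n)))
  Φ-suc n = lastOr-∷ʳ [ + 1 ] (cycTable n) _

  Φ-unfold : ∀ {n m} → n ≡ suc m → Φ n ≡ trim (quotMonic (suc n) (xnm1 n) (prodDivisors n 1 (cycTable m)))
  Φ-unfold {m = m} refl = Φ-suc m

  cycTable-applyUpTo : ∀ n → cycTable n ≡ applyUpTo (Φ ∘ suc) n
  cycTable-applyUpTo zero    = refl
  cycTable-applyUpTo (suc n) = begin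
    cycTable n ∷ʳ _                        ≡⟨ cong₂ _∷ʳ_ (cycTable-applyUpTo n) (sym (Φ-suc n)) ⟩
    applyUpTo (Φ ∘ suc) n ∷ʳ Φ (suc n)     ≡⟨ applyUpTo-∷ʳ (Φ ∘ suc) n ⟩
    applyUpTo (Φ ∘ suc) (suc n)            ∎
    where open ≡-Reasoning

  applyUpTo-+ : ∀ {A : Set} (f : ℕ → A) m n → applyUpTo f (m ℕ.+ n) ≡ applyUpTo f m ++ applyUpTo (f ∘ (m ℕ.+_)) n
  applyUpTo-+ f zero    n = refl
  applyUpTo-+ f (suc m) n = cong (f 0 ∷_) (applyUpTo-+ (f ∘ suc) m n)

  prodDivisors-∣ : ∀ {n d} φ L → d ∣ n → prodDivisors n d (φ ∷ L) ≡ mulP φ (prodDivisors n (suc d) L)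
  prodDivisors-∣ {n} {d} φ L d∣n rewrite dec-true (d ∣? n) d∣n = refl

  prodDivisors-skip : ∀ n d L L′ → (∀ j → j < length L → ¬ (d ℕ.+ j) ∣ n) →
                      prodDivisors n d (L ++ L′) ≈ prodDivisors n (d ℕ.+ length L) L′
  prodDivisors-skip n d []      L′ _   = ≈-reflexive (cong (λ e → prodDivisors n e L′) (sym (ℕP.+-identityʳ d)))
  prodDivisors-skip n d (φ ∷ L) L′ d∤n rewrite dec-false (d ∣? n) (subst (λ e → ¬ e ∣ n) (ℕP.+-identityʳ d) (d∤n 0 (s≤s z≤n))) = begin
    mulP [ + 1 ] (prodDivisors n (suc d) (L ++ L′))   ≈⟨ mulP-identityˡ _ ⟩
    prodDivisors n (suc d) (L ++ L′)
      ≈⟨ prodDivisors-skip n (suc d) L L′ (λ j j<len → subst (λ e → ¬ e ∣ n) (ℕP.+-suc d j) (d∤n (suc j) (s≤s j<len))) ⟩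
    prodDivisors n (suc d ℕ.+ length L) L′            ≡⟨ cong (λ e → prodDivisors n e L′) (sym (ℕP.+-suc d (length L))) ⟩
    prodDivisors n (d ℕ.+ suc (length L)) L′          ∎
    where open SetoidReasoning ≈-setoid

  prodDivisors-prime : ∀ {p} → Prime p → ∀ (g : ℕ → List ℤ) →
    prodDivisors p 1 (applyUpTo g (ℕ.pred p)) ≈ mulP (g 0) [ + 1 ]
  prodDivisors-prime {0}           () g
  prodDivisors-prime {1}           () g
  prodDivisors-prime {suc (suc q)} pr g = begin
    prodDivisors p 1 (g 0 ∷ B)          ≡⟨ cong (λ L → prodDivisors p 1 (g 0 ∷ L)) (sym (++-identityʳ B)) ⟩
    prodDivisors p 1 (g 0 ∷ (B ++ []))  ≡⟨ prodDivisors-∣ (g 0) (B ++ []) (1∣ p) ⟩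
    mulP (g 0) (prodDivisors p 2 (B ++ [])) ≈⟨ mulP-congʳ (g 0) (prodDivisors-skip p 2 B [] 2+j∤p) ⟩
    mulP (g 0) [ + 1 ]                  ∎
    where
    open SetoidReasoning ≈-setoid
    p = suc (suc q)
    B = applyUpTo (g ∘ suc) q
    2+j∤p : ∀ j → j < length B → ¬ (2 ℕ.+ j) ∣ p
    2+j∤p j j<len 2+j∣p with prime⇒irreducible pr 2+j∣p
    ... | inj₂ 2+j≡p = ℕP.<⇒≢ (subst (j <_) (length-applyUpTo _ q) j<len) (ℕP.suc-injective (ℕP.suc-injective 2+j≡p))

  last-block-end : ∀ r → suc (3 ℕ.+ r) ℕ.+ suc (suc (r ℕ.+ 0)) ≡ 2 ℕ.* (3 ℕ.+ r)
  last-block-end = solve-∀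

  prodDivisors-twice-prime : ∀ {p} → Prime p → p ≢ 2 → ∀ (g : ℕ → List ℤ) →
    prodDivisors (2 ℕ.* p) 1 (applyUpTo g (ℕ.pred (2 ℕ.* p))) ≈ mulP (g 0) (mulP (g 1) (mulP (g (ℕ.pred p)) [ + 1 ]))
  prodDivisors-twice-prime {0}                 () _   g
  prodDivisors-twice-prime {1}                 () _   g
  prodDivisors-twice-prime {2}                 _  p≢2 g = ⊥-elim (p≢2 refl)
  prodDivisors-twice-prime {suc (suc (suc r))} pr p≢2 g = begin
    prodDivisors 2p 1 (applyUpTo g (ℕ.pred 2p))
      ≡⟨ cong (prodDivisors 2p 1) split ⟩
    prodDivisors 2p 1 (g 0 ∷ g 1 ∷ (B₁ ++ (g (2 ℕ.+ (r ℕ.+ 0)) ∷ (B₂ ++ []))))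
      ≡⟨ trans (prodDivisors-∣ (g 0) (g 1 ∷ rest) (1∣ 2p)) (cong (mulP (g 0)) (prodDivisors-∣ (g 1) rest (m∣m*n {2} p))) ⟩
    mulP (g 0) (mulP (g 1) (prodDivisors 2p 3 (B₁ ++ (g (2 ℕ.+ (r ℕ.+ 0)) ∷ (B₂ ++ [])))))
      ≈⟨ inside (prodDivisors-skip 2p 3 B₁ _ B₁∤2p) ⟩
    mulP (g 0) (mulP (g 1) (prodDivisors 2p (3 ℕ.+ length B₁) (g (2 ℕ.+ (r ℕ.+ 0)) ∷ (B₂ ++ []))))
      ≡⟨ cong₂ (λ d n → mulP (g 0) (mulP (g 1) (prodDivisors 2p (3 ℕ.+ d) (g (2 ℕ.+ n) ∷ (B₂ ++ [])))))
               (length-applyUpTo (g ∘ suc ∘ suc) r) (ℕP.+-identityʳ r) ⟩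
    mulP (g 0) (mulP (g 1) (prodDivisors 2p p (g (ℕ.pred p) ∷ (B₂ ++ []))))
      ≡⟨ cong (λ x → mulP (g 0) (mulP (g 1) x)) (prodDivisors-∣ (g (ℕ.pred p)) (B₂ ++ []) (n∣m*n 2 {p})) ⟩
    mulP (g 0) (mulP (g 1) (mulP (g (ℕ.pred p)) (prodDivisors 2p (suc p) (B₂ ++ []))))
      ≈⟨ inside (mulP-congʳ (g (ℕ.pred p)) (prodDivisors-skip 2p (suc p) B₂ [] B₂∤2p)) ⟩
    mulP (g 0) (mulP (g 1) (mulP (g (ℕ.pred p)) [ + 1 ]))
      ∎
    where
    open SetoidReasoning ≈-setoid
    p  = suc (suc (suc r))
    2p = 2 ℕ.* p
    B₁ = applyUpTo (g ∘ suc ∘ suc) r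
    B₂ = applyUpTo ((g ∘ suc ∘ suc) ∘ (r ℕ.+_) ∘ suc) (suc (suc (r ℕ.+ 0)))
    rest = B₁ ++ (g (2 ℕ.+ (r ℕ.+ 0)) ∷ (B₂ ++ []))

    split : applyUpTo g (ℕ.pred 2p) ≡ g 0 ∷ g 1 ∷ (B₁ ++ (g (2 ℕ.+ (r ℕ.+ 0)) ∷ (B₂ ++ [])))
    split = cong (λ L → g 0 ∷ g 1 ∷ L)
                 (trans (applyUpTo-+ (g ∘ suc ∘ suc) r (p ℕ.+ 0)) (cong (λ L → B₁ ++ (g (2 ℕ.+ (r ℕ.+ 0)) ∷ L)) (sym (++-identityʳ B₂))))

    inside : ∀ {x y} → x ≈ y → mulP (g 0) (mulP (g 1) x) ≈ mulP (g 0) (mulP (g 1) y)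
    inside x≈y = mulP-congʳ (g 0) (mulP-congʳ (g 1) x≈y)

    B₁∤2p : ∀ j → j < length B₁ → ¬ (3 ℕ.+ j) ∣ 2p
    B₁∤2p j j<len = ∤-twice-prime pr (s≤s (s≤s (s≤s z≤n))) (ℕP.<-≤-trans 3+j<p (ℕP.m≤m+n p (p ℕ.+ 0))) (ℕP.<⇒≢ 3+j<p)
      where
      3+j<p : 3 ℕ.+ j < p
      3+j<p = s≤s (s≤s (s≤s (subst (j <_) (length-applyUpTo (g ∘ suc ∘ suc) r) j<len)))

    B₂∤2p : ∀ j → j < length B₂ → ¬ (suc p ℕ.+ j) ∣ 2p
    B₂∤2p j j<len = ∤-twice-prime pr (s≤s (s≤s (s≤s z≤n))) d<2p (ℕP.>⇒≢ (s≤s (ℕP.m≤m+n p j)))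
      where
      d<2p : suc p ℕ.+ j < 2p
      d<2p = subst (suc p ℕ.+ j <_) (last-block-end r)
                   (ℕP.+-monoʳ-< (suc p) (subst (j <_) (length-applyUpTo ((g ∘ suc ∘ suc) ∘ (r ℕ.+_) ∘ suc) (suc (suc (r ℕ.+ 0)))) j<len))

  -- Φ p and Φ 2p

  monic-linear : ∀ a → Monic 1 (a ∷ [ + 1 ])
  monic-linear a = monic refl (coeff-≥length (a ∷ [ + 1 ]))

  xnm1-telescope : ∀ n → mulP (-[1+ 0 ] ∷ [ + 1 ]) (geometric (+ 1) (suc n)) ≈ xnm1 (suc n)
  xnm1-telescope n =
    ≈-trans (geometric-telescope (+ 1) n) (≈-reflexive (cong (λ c → addP (monomial c (suc n)) [ -[1+ 0 ] ]) (1^n≡1 (suc n))))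

  alternating-telescope : ∀ h → mulP (+ 1 ∷ [ + 1 ]) (geometric -[1+ 0 ] (suc (h ℕ.* 2))) ≈ addP (monomial (+ 1) (suc (h ℕ.* 2))) [ + 1 ]
  alternating-telescope h = begin
    mulP (scaleP -[1+ 0 ] (-[1+ 0 ] ∷ [ -[1+ 0 ] ])) G              ≈⟨ mulP-scalePˡ -[1+ 0 ] (-[1+ 0 ] ∷ [ -[1+ 0 ] ]) G ⟩
    scaleP -[1+ 0 ] (mulP (-[1+ 0 ] ∷ [ -[1+ 0 ] ]) G)              ≈⟨ scaleP-cong -[1+ 0 ] (geometric-telescope -[1+ 0 ] (h ℕ.* 2)) ⟩
    scaleP -[1+ 0 ] (addP (monomial (-[1+ 0 ] ^ n) n) [ -[1+ 0 ] ])   ≈⟨ scaleP-addP -[1+ 0 ] (monomial (-[1+ 0 ] ^ n) n) [ -[1+ 0 ] ] ⟩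
    addP (scaleP -[1+ 0 ] (monomial (-[1+ 0 ] ^ n) n)) [ + 1 ]      ≈⟨ addP-cong {g = [ + 1 ]} (scaleP-shift -[1+ 0 ] n [ -[1+ 0 ] ^ n ]) ≈-refl ⟩
    addP (monomial (-[1+ 0 ] ℤ.* (-[1+ 0 ] ^ n)) n) [ + 1 ]          ≡⟨ cong (λ c → addP (monomial (-[1+ 0 ] ℤ.* (-[1+ 0 ] ℤ.* c)) n) [ + 1 ])
                                                                             (involution-^-even refl h) ⟩
    addP (monomial (+ 1) n) [ + 1 ]                                 ∎
    where
    open SetoidReasoning ≈-setoid
    n = suc (h ℕ.* 2)
    G = geometric -[1+ 0 ] n

  Φ-prime : ∀ {p} → Prime p → Φ p ≈ geometric (+ 1) p
  Φ-prime {0}           ()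
  Φ-prime {1}           ()
  Φ-prime {suc (suc q)} pr = begin
    Φ p                                  ≡⟨ Φ-unfold {m = suc q} refl ⟩
    trim (quotMonic (suc p) (xnm1 p) b)  ≈⟨ coeff-trim _ ⟩
    quotMonic (suc p) (xnm1 p) b         ≈⟨ quotMonic-exact (monic-cong (≈-sym b≈Φ₁) (monic-linear -[1+ 0 ])) (reverseView G) (suc p) (xnm1 p)
                                                            (ℕP.≤-trans (ℕP.≤-reflexive (length-geometric (+ 1) p)) (ℕP.n≤1+n p))
                                                            (≈-trans (≈-sym (xnm1-telescope (suc q))) (mulP-congˡ G (≈-sym b≈Φ₁))) ⟩
    G                                    ∎
    where
    open SetoidReasoning ≈-setoid
    p = suc (suc q)
    G = geometric (+ 1) p
    b = prodDivisors p 1 (cycTable (suc q))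
    b≈Φ₁ : b ≈ (-[1+ 0 ] ∷ [ + 1 ])
    b≈Φ₁ = begin
      b                                                ≡⟨ cong (prodDivisors p 1) (cycTable-applyUpTo (suc q)) ⟩
      prodDivisors p 1 (applyUpTo (Φ ∘ suc) (suc q))   ≈⟨ prodDivisors-prime pr (Φ ∘ suc) ⟩
      mulP (Φ 1) [ + 1 ]                               ≈⟨ mulP-identityʳ (Φ 1) ⟩
      -[1+ 0 ] ∷ [ + 1 ]                               ∎

  Φ-twice-prime : ∀ {p} → Prime p → p ≢ 2 → Φ (2 ℕ.* p) ≈ geometric -[1+ 0 ] p
  Φ-twice-prime {0}                 () _
  Φ-twice-prime {1}                 () _
  Φ-twice-prime {2}                 _  p≢2 = ⊥-elim (p≢2 refl)
  Φ-twice-prime {p@(suc (suc (suc r)))} pr p≢2 = begin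
    Φ 2p                                     ≡⟨ Φ-unfold {2p} {ℕ.pred 2p} refl ⟩
    trim (quotMonic (suc 2p) (xnm1 2p) b)    ≈⟨ coeff-trim _ ⟩
    quotMonic (suc 2p) (xnm1 2p) b           ≈⟨ quotMonic-exact monic-b (reverseView G₋) (suc 2p) (xnm1 2p) length≤ x²ᵖ-1≈b·G₋ ⟩
    G₋                                       ∎
    where
    open SetoidReasoning ≈-setoid
    2p = 2 ℕ.* p
    G₊ = geometric (+ 1) p
    G₋ = geometric -[1+ 0 ] p
    Φ₁ = -[1+ 0 ] ∷ [ + 1 ]
    Φ₂ = + 1 ∷ [ + 1 ]
    b  = prodDivisors 2p 1 (cycTable (ℕ.pred 2p))

    b≈ : b ≈ mulP Φ₁ (mulP Φ₂ G₊)
    b≈ = begin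
      b                                                                   ≡⟨ cong (prodDivisors 2p 1) (cycTable-applyUpTo (ℕ.pred 2p)) ⟩
      prodDivisors 2p 1 (applyUpTo (Φ ∘ suc) (ℕ.pred 2p))                 ≈⟨ prodDivisors-twice-prime pr p≢2 (Φ ∘ suc) ⟩
      mulP (Φ 1) (mulP (Φ 2) (mulP (Φ (suc (ℕ.pred p))) [ + 1 ]))         ≈⟨ mulP-congʳ Φ₁ (mulP-congʳ Φ₂ (≈-trans (mulP-identityʳ _) Φp≈G₊)) ⟩
      mulP Φ₁ (mulP Φ₂ G₊)                                                ∎
      where
      Φp≈G₊ : Φ (suc (ℕ.pred p)) ≈ G₊
      Φp≈G₊ = subst (λ n → Φ n ≈ G₊) {p} {suc (ℕ.pred p)} refl (Φ-prime pr)

    monic-b : Monic (suc p) b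
    monic-b = monic-cong (≈-sym b≈) (monic-mulP (monic-linear -[1+ 0 ]) (monic-mulP (monic-linear (+ 1)) (monic-geometric-1 (suc (suc r)))))

    length≤ : length G₋ ≤ suc 2p
    length≤ = subst (_≤ suc 2p) (sym (length-geometric -[1+ 0 ] p)) (ℕP.≤-trans (ℕP.m≤m+n p (p ℕ.+ 0)) (ℕP.n≤1+n 2p))

    Φ₂·G₋ : mulP Φ₂ G₋ ≈ addP (monomial (+ 1) p) [ + 1 ]
    Φ₂·G₋ = subst (λ n → mulP Φ₂ (geometric -[1+ 0 ] n) ≈ addP (monomial (+ 1) n) [ + 1 ])
                  (sym (odd-prime pr p≢2)) (alternating-telescope (p / 2))

    x²ᵖ-1≈b·G₋ : xnm1 2p ≈ mulP b G₋
    x²ᵖ-1≈b·G₋ = begin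
      xnm1 2p                                                        ≡⟨ cong (λ n → addP (monomial (+ 1) (p ℕ.+ n)) [ -[1+ 0 ] ]) (ℕP.+-identityʳ p) ⟩
      addP (monomial (+ 1) (p ℕ.+ p)) [ -[1+ 0 ] ]                   ≈⟨ difference-of-squares p ⟨
      mulP (addP (monomial (+ 1) p) [ -[1+ 0 ] ]) (addP (monomial (+ 1) p) [ + 1 ])
        ≈⟨ ≈-trans (mulP-congˡ (addP (monomial (+ 1) p) [ + 1 ]) (≈-sym (xnm1-telescope (suc (suc r)))))
                   (mulP-congʳ (mulP Φ₁ G₊) (≈-sym Φ₂·G₋)) ⟩
      mulP (mulP Φ₁ G₊) (mulP Φ₂ G₋)                                 ≈⟨ mulP-regroup Φ₁ Φ₂ G₊ G₋ ⟨
      mulP (mulP Φ₁ (mulP Φ₂ G₊)) G₋                                 ≈⟨ mulP-congˡ G₋ b≈ ⟨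
      mulP b G₋                                                      ∎

-- Residues modulo p

avoid-two : ∀ {A : Set} → DecidableEquality A → ∀ {x y z} → x ≢ y → x ≢ z → y ≢ z →
            ∀ a b → (x ≢ a × x ≢ b) ⊎ (y ≢ a × y ≢ b) ⊎ (z ≢ a × z ≢ b)
avoid-two _≟_ {x} {y} {z} x≢y x≢z y≢z a b with x ≟ a | x ≟ b
... | no x≢a | no x≢b = inj₁ (x≢a , x≢b)
... | yes refl | _ with y ≟ b
...   | no y≢b  = inj₂ (inj₁ ((λ y≡x → x≢y (sym y≡x)) , y≢b))
...   | yes refl = inj₂ (inj₂ ((λ z≡x → x≢z (sym z≡x)) , (λ z≡y → y≢z (sym z≡y))))
avoid-two _≟_ {x} {y} {z} x≢y x≢z y≢z a b | no x≢a | yes refl with y ≟ a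
...   | no y≢a  = inj₂ (inj₁ (y≢a , (λ y≡x → x≢y (sym y≡x))))
...   | yes refl = inj₂ (inj₂ ((λ z≡y → y≢z (sym z≡y)) , (λ z≡x → x≢z (sym z≡x))))

module ResiduesModulo (p′ : ℕ) where

  p : ℕ
  p = suc p′

  %-apart : ∀ e d {e′} → e ℕ.+ d ≡ e′ → 0 < d → d ≤ p′ → e % p ≢ e′ % p
  %-apart e d refl 0<d d≤p′ r≡e′%p = wrap-around? (r ℕ.+ d <? p)
    where
    r = e % p
    r<p : r < p
    r<p = m%n<n e p
    r≡[r+d]%p : r ≡ (r ℕ.+ d) % p
    r≡[r+d]%p = trans r≡e′%p (trans (%-distribˡ-+ e d p) (cong (λ x → (r ℕ.+ x) % p) (m<n⇒m%n≡m (s≤s d≤p′))))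
    wrap-around? : Dec (r ℕ.+ d < p) → ⊥
    wrap-around? (yes r+d<p) = ℕP.<⇒≢ 0<d (sym (ℕP.+-cancelˡ-≡ r d 0 (trans (sym (trans r≡[r+d]%p (m<n⇒m%n≡m r+d<p))) (sym (ℕP.+-identityʳ r)))))
    wrap-around? (no r+d≮p) = ℕP.<⇒≢ (s≤s d≤p′) (sym (ℕP.+-cancelˡ-≡ r p d (trans (ℕP.+-comm r p) (trans (cong (p ℕ.+_) r≡s) p+s≡r+d))))
      where
      s = r ℕ.+ d ℕ.∸ p
      p+s≡r+d : p ℕ.+ s ≡ r ℕ.+ d
      p+s≡r+d = ℕP.m+[n∸m]≡n (ℕP.≮⇒≥ r+d≮p)
      s<p : s < p
      s<p = ℕP.+-cancelˡ-< p s p (subst (_< p ℕ.+ p) (sym p+s≡r+d) (ℕP.+-mono-< r<p (s≤s d≤p′)))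
      r≡s : r ≡ s
      r≡s = trans r≡[r+d]%p (trans (cong (_% p) (trans (sym p+s≡r+d) (ℕP.+-comm p s))) (trans ([m+n]%n≡m%n s p) (m<n⇒m%n≡m s<p)))

  -- The offsets are numerals, so their side conditions are discharged by evaluation.
  module Window (10≤p′ : 10 ≤ p′) {t : ℕ} (4≤t : 4 ≤ t) where

    private
      lit : ∀ n {n≤10 : True (n ≤? 10)} → n ≤ p′
      lit n {n≤10} = ℕP.≤-trans (toWitness n≤10) 10≤p′

    apart : ∀ d {0<d : True (0 <? d)} {d≤10 : True (d ≤? 10)} → t % p ≢ (t ℕ.+ d) % p
    apart d {0<d} {d≤10} = %-apart t d refl (toWitness 0<d) (lit d {d≤10})

    apart-+ : ∀ a d {0<d : True (0 <? d)} {d≤10 : True (d ≤? 10)} → (t ℕ.+ a) % p ≢ (t ℕ.+ (a ℕ.+ d)) % p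
    apart-+ a d {0<d} {d≤10} = %-apart (t ℕ.+ a) d (ℕP.+-assoc t a d) (toWitness 0<d) (lit d {d≤10})

    apart-∸ : ∀ a d {a≤4 : True (a ≤? 4)} {0<a+d : True (0 <? a ℕ.+ d)} {a+d≤10 : True (a ℕ.+ d ≤? 10)} →
              (t ∸ a) % p ≢ (t ℕ.+ d) % p
    apart-∸ a d {a≤4} {0<a+d} {a+d≤10} =
      %-apart (t ∸ a) (a ℕ.+ d) (trans (sym (ℕP.+-assoc (t ∸ a) a d)) (cong (ℕ._+ d) (ℕP.m∸n+n≡m (ℕP.≤-trans (toWitness a≤4) 4≤t))))
              (toWitness 0<a+d) (lit (a ℕ.+ d) {a+d≤10})

    apart-∸₀ : ∀ a {a≤4 : True (a ≤? 4)} {0<a : True (0 <? a)} → (t ∸ a) % p ≢ t % p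
    apart-∸₀ a {a≤4} {0<a} = %-apart (t ∸ a) a (ℕP.m∸n+n≡m (ℕP.≤-trans (toWitness a≤4) 4≤t)) (toWitness 0<a) (ℕP.≤-trans (toWitness a≤4) (lit 4))

module ℚ[x] = RingPolynomials ℚP.+-*-isCommutativeRing

open ℤ[x] using () renaming (_≈_ to _≈ᶻ_; at to atᶻ)
open CyclotomicValues using (Φ-prime; Φ-twice-prime; odd-prime)
open ℚ[x] using (_≈_; coeffwise; at; ≈-refl; ≈-sym; ≈-trans; ≈-reflexive; ≈-setoid; addP-cong; mulP-congˡ;
                 geometric; monomials; involution-^-even; involution-*-nonzero; 1^n≡1)

ι : ℤ → ℚ
ι z = z ℚ./ 1

ι≡mkℚ : ∀ a → ι a ≡ mkℚ a 0 (Coprimality.sym (Coprimality.1-coprimeTo ℤ.∣ a ∣))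
ι≡mkℚ a = ℚP.↥p/↧p≡p (mkℚ a 0 (Coprimality.sym (Coprimality.1-coprimeTo ℤ.∣ a ∣)))

ι-+ : ∀ a b → ι (a ℤ.+ b) ≡ ι a ℚ.+ ι b
ι-+ a b rewrite ι≡mkℚ a | ι≡mkℚ b = cong ι (sym (cong₂ ℤ._+_ (ℤP.*-identityʳ a) (ℤP.*-identityʳ b)))

ι-* : ∀ a b → ι (a ℤ.* b) ≡ ι a ℚ.* ι b
ι-* a b rewrite ι≡mkℚ a | ι≡mkℚ b = refl

coeff-toℚ : ∀ f i → ℚ[x].coeff (toℚ f) i ≡ ι (ℤ[x].coeff f i)
coeff-toℚ []      i       = refl
coeff-toℚ (a ∷ f) zero    = refl
coeff-toℚ (a ∷ f) (suc i) = coeff-toℚ f i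

toℚ-cong : ∀ {f g} → f ≈ᶻ g → toℚ f ≈ toℚ g
toℚ-cong {f} {g} f≈g = coeffwise λ i → trans (coeff-toℚ f i) (trans (cong ι (atᶻ f≈g i)) (sym (coeff-toℚ g i)))

toℚ-addP : ∀ f g → toℚ (ZP.addP f g) ≈ ℚ[x].addP (toℚ f) (toℚ g)
toℚ-addP f g = coeffwise λ i → begin
  ℚ[x].coeff (toℚ (ZP.addP f g)) i                        ≡⟨ coeff-toℚ (ZP.addP f g) i ⟩
  ι (ℤ[x].coeff (ZP.addP f g) i)                          ≡⟨ cong ι (ℤ[x].coeff-addP f g i) ⟩
  ι (ℤ[x].coeff f i ℤ.+ ℤ[x].coeff g i)                   ≡⟨ ι-+ (ℤ[x].coeff f i) (ℤ[x].coeff g i) ⟩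
  ι (ℤ[x].coeff f i) ℚ.+ ι (ℤ[x].coeff g i)               ≡⟨ cong₂ ℚ._+_ (coeff-toℚ f i) (coeff-toℚ g i) ⟨
  ℚ[x].coeff (toℚ f) i ℚ.+ ℚ[x].coeff (toℚ g) i           ≡⟨ ℚ[x].coeff-addP (toℚ f) (toℚ g) i ⟨
  ℚ[x].coeff (ℚ[x].addP (toℚ f) (toℚ g)) i                ∎
  where open ≡-Reasoning

toℚ-monomial : ∀ c e → toℚ (ZP.monomial c e) ≡ ℚ[x].monomial (ι c) e
toℚ-monomial c e = trans (map-++ ι (replicate e (+ 0)) [ c ]) (cong (_++ [ ι c ]) (map-replicate ι e (+ 0)))

toℚ-poly : ∀ ts → toℚ (poly ts) ≈ monomials (map (map₁ ι) ts)
toℚ-poly []             = ≈-refl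
toℚ-poly ((c , e) ∷ ts) =
  ≈-trans (toℚ-addP (ZP.monomial c e) (poly ts)) (addP-cong (≈-reflexive (toℚ-monomial c e)) (toℚ-poly ts))

toℚ-geometric : ∀ σ n → toℚ (ℤ[x].geometric σ n) ≈ geometric (ι σ) n
toℚ-geometric σ zero    = ≈-refl
toℚ-geometric σ (suc n) = ℚ[x].∷-cong refl (coeffwise λ i → begin
  ℚ[x].coeff (toℚ (ZP.scaleP σ (ℤ[x].geometric σ n))) i      ≡⟨ coeff-toℚ (ZP.scaleP σ (ℤ[x].geometric σ n)) i ⟩
  ι (ℤ[x].coeff (ZP.scaleP σ (ℤ[x].geometric σ n)) i)        ≡⟨ cong ι (ℤ[x].coeff-scaleP σ (ℤ[x].geometric σ n) i) ⟩
  ι (σ ℤ.* ℤ[x].coeff (ℤ[x].geometric σ n) i)                ≡⟨ ι-* σ (ℤ[x].coeff (ℤ[x].geometric σ n) i) ⟩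
  ι σ ℚ.* ι (ℤ[x].coeff (ℤ[x].geometric σ n) i)              ≡⟨ cong (ι σ ℚ.*_) (trans (sym (coeff-toℚ (ℤ[x].geometric σ n) i)) (at (toℚ-geometric σ n) i)) ⟩
  ι σ ℚ.* ℚ[x].coeff (geometric (ι σ) n) i                   ≡⟨ ℚ[x].coeff-scaleP (ι σ) (geometric (ι σ) n) i ⟨
  ℚ[x].coeff (ℚ[x].scaleP (ι σ) (geometric (ι σ) n)) i       ∎)
  where open ≡-Reasoning

shape : ∀ {A : Set} → ℕ → Vec A 10 → List (A × ℕ)
shape t (c₀ ∷ c₁ ∷ c₂ ∷ c₃ ∷ c₄ ∷ c₅ ∷ c₆ ∷ c₇ ∷ c₈ ∷ c₉ ∷ []) =
  (c₀ , 2 ℕ.* t ∸ 1) ∷ (c₁ , t ℕ.+ 3) ∷ (c₂ , t ℕ.+ 2) ∷ (c₃ , t ℕ.+ 1) ∷ (c₄ , t) ∷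
  (c₅ , t ∸ 1) ∷ (c₆ , t ∸ 2) ∷ (c₇ , t ∸ 3) ∷ (c₈ , t ∸ 4) ∷ (c₉ , 0) ∷ []

map-shape : ∀ {A B : Set} (f : A → B) t cs → map (map₁ f) (shape t cs) ≡ shape t (Vec.map f cs)
map-shape f t (c₀ ∷ c₁ ∷ c₂ ∷ c₃ ∷ c₄ ∷ c₅ ∷ c₆ ∷ c₇ ∷ c₈ ∷ c₉ ∷ []) = refl

MiddleNonzero : Vec ℚ 10 → Set
MiddleNonzero (_ ∷ _ ∷ c₂ ∷ c₃ ∷ c₄ ∷ _) = c₂ ≢ 0ℚ × c₃ ≢ 0ℚ × c₄ ≢ 0ℚ

coeffs-U coeffs-W : Vec ℤ 10
coeffs-U = + 2 ∷ + 1 ∷ -[1+ 0 ] ∷ + 1 ∷ -[1+ 2 ] ∷ + 3 ∷ -[1+ 0 ] ∷ + 1 ∷ -[1+ 0 ] ∷ -[1+ 1 ] ∷ []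
coeffs-W = + 2 ∷ -[1+ 0 ] ∷ + 1 ∷ -[1+ 0 ] ∷ -[1+ 0 ] ∷ + 1 ∷ + 1 ∷ -[1+ 0 ] ∷ + 1 ∷ -[1+ 1 ] ∷ []

module ShapeReduction (p′ : ℕ) (10≤p′ : 10 ≤ p′) (ε : ℚ) {t : ℕ} (4≤t : 4 ≤ t) where

  open ℚ[x].Reduction p′ ε
  open ResiduesModulo.Window p′ 10≤p′ 4≤t

  -- One of the three exponents t + 4, t + 5, t + 6 (resp. t, t + 1, t + 2) avoids the residues of the
  -- outer exponents 2t - 1 and 0, and no other exponent of the shape shares their residue.
  shape-reduce-zero : ∀ cs → ∃[ k ] k ≤ p′ × reduce k (monomials (shape t cs)) ≡ 0ℚ
  shape-reduce-zero cs@(c₀ ∷ c₁ ∷ c₂ ∷ c₃ ∷ c₄ ∷ c₅ ∷ c₆ ∷ c₇ ∷ c₈ ∷ c₉ ∷ [])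
    with avoid-two ℕ._≟_ (apart-+ 4 1) (apart-+ 4 2) (apart-+ 5 1) ((2 ℕ.* t ∸ 1) % p) (0 % p)
  ... | inj₁ (g₁ , g₂) = (t ℕ.+ 4) % p , %p≤p′ (t ℕ.+ 4) , reduce-monomials-miss {ts = shape t cs} (%p≤p′ (t ℕ.+ 4))
        (≢-sym g₁ ∷ apart-+ 3 1 ∷ apart-+ 2 2 ∷ apart-+ 1 3 ∷ apart 4 ∷
         apart-∸ 1 4 ∷ apart-∸ 2 4 ∷ apart-∸ 3 4 ∷ apart-∸ 4 4 ∷ ≢-sym g₂ ∷ [])
  ... | inj₂ (inj₁ (g₁ , g₂)) = (t ℕ.+ 5) % p , %p≤p′ (t ℕ.+ 5) , reduce-monomials-miss {ts = shape t cs} (%p≤p′ (t ℕ.+ 5))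
        (≢-sym g₁ ∷ apart-+ 3 2 ∷ apart-+ 2 3 ∷ apart-+ 1 4 ∷ apart 5 ∷
         apart-∸ 1 5 ∷ apart-∸ 2 5 ∷ apart-∸ 3 5 ∷ apart-∸ 4 5 ∷ ≢-sym g₂ ∷ [])
  ... | inj₂ (inj₂ (g₁ , g₂)) = (t ℕ.+ 6) % p , %p≤p′ (t ℕ.+ 6) , reduce-monomials-miss {ts = shape t cs} (%p≤p′ (t ℕ.+ 6))
        (≢-sym g₁ ∷ apart-+ 3 3 ∷ apart-+ 2 4 ∷ apart-+ 1 5 ∷ apart 6 ∷
         apart-∸ 1 6 ∷ apart-∸ 2 6 ∷ apart-∸ 3 6 ∷ apart-∸ 4 6 ∷ ≢-sym g₂ ∷ [])

  private
    nonzero : ε ℚ.* ε ≡ 1ℚ → ∀ q {c x} → c ≢ 0ℚ → x ≡ ε ℚ[x].^ q ℚ.* c → x ≢ 0ℚ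
    nonzero ε²≡1 q c≢0 refl = involution-*-nonzero {ε ℚ[x].^ q} (ℚ[x].involution-^ {ε} ε²≡1 q) c≢0

  shape-reduce-nonzero : ε ℚ.* ε ≡ 1ℚ → ∀ cs → MiddleNonzero cs → ∃[ k ] k ≤ p′ × reduce k (monomials (shape t cs)) ≢ 0ℚ
  shape-reduce-nonzero ε²≡1 cs@(c₀ ∷ c₁ ∷ c₂ ∷ c₃ ∷ c₄ ∷ c₅ ∷ c₆ ∷ c₇ ∷ c₈ ∷ c₉ ∷ []) (c₂≢0 , c₃≢0 , c₄≢0)
    with avoid-two ℕ._≟_ (apart 1) (apart 2) (apart-+ 1 1) ((2 ℕ.* t ∸ 1) % p) (0 % p)
  ... | inj₁ (g₁ , g₂) = t % p , %p≤p′ t , nonzero ε²≡1 (t / p) c₄≢0 (reduce-monomials-hit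
        ((c₀ , 2 ℕ.* t ∸ 1) ∷ (c₁ , t ℕ.+ 3) ∷ (c₂ , t ℕ.+ 2) ∷ (c₃ , t ℕ.+ 1) ∷ []) c₄ t
        ((c₅ , t ∸ 1) ∷ (c₆ , t ∸ 2) ∷ (c₇ , t ∸ 3) ∷ (c₈ , t ∸ 4) ∷ (c₉ , 0) ∷ [])
        (≢-sym g₁ ∷ ≢-sym (apart 3) ∷ ≢-sym (apart 2) ∷ ≢-sym (apart 1) ∷ [])
        (apart-∸₀ 1 ∷ apart-∸₀ 2 ∷ apart-∸₀ 3 ∷ apart-∸₀ 4 ∷ ≢-sym g₂ ∷ []))
  ... | inj₂ (inj₁ (g₁ , g₂)) = (t ℕ.+ 1) % p , %p≤p′ (t ℕ.+ 1) , nonzero ε²≡1 ((t ℕ.+ 1) / p) c₃≢0 (reduce-monomials-hit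
        ((c₀ , 2 ℕ.* t ∸ 1) ∷ (c₁ , t ℕ.+ 3) ∷ (c₂ , t ℕ.+ 2) ∷ []) c₃ (t ℕ.+ 1)
        ((c₄ , t) ∷ (c₅ , t ∸ 1) ∷ (c₆ , t ∸ 2) ∷ (c₇ , t ∸ 3) ∷ (c₈ , t ∸ 4) ∷ (c₉ , 0) ∷ [])
        (≢-sym g₁ ∷ ≢-sym (apart-+ 1 2) ∷ ≢-sym (apart-+ 1 1) ∷ [])
        (apart 1 ∷ apart-∸ 1 1 ∷ apart-∸ 2 1 ∷ apart-∸ 3 1 ∷ apart-∸ 4 1 ∷ ≢-sym g₂ ∷ []))
  ... | inj₂ (inj₂ (g₁ , g₂)) = (t ℕ.+ 2) % p , %p≤p′ (t ℕ.+ 2) , nonzero ε²≡1 ((t ℕ.+ 2) / p) c₂≢0 (reduce-monomials-hit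
        ((c₀ , 2 ℕ.* t ∸ 1) ∷ (c₁ , t ℕ.+ 3) ∷ []) c₂ (t ℕ.+ 2)
        ((c₃ , t ℕ.+ 1) ∷ (c₄ , t) ∷ (c₅ , t ∸ 1) ∷ (c₆ , t ∸ 2) ∷ (c₇ , t ∸ 3) ∷ (c₈ , t ∸ 4) ∷ (c₉ , 0) ∷ [])
        (≢-sym g₁ ∷ ≢-sym (apart-+ 2 1) ∷ [])
        (apart-+ 1 1 ∷ apart 2 ∷ apart-∸ 1 2 ∷ apart-∸ 2 2 ∷ apart-∸ 3 2 ∷ apart-∸ 4 2 ∷ ≢-sym g₂ ∷ []))

shape-not-divisible : ∀ {p′ t} → 10 ≤ p′ → 4 ≤ t → ∀ {Φ σ} → toℚ Φ ≈ geometric σ (suc p′) →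
                      σ ℚ.* σ ≡ 1ℚ → σ ℚ[x].^ suc p′ ℚ.* σ ≡ 1ℚ →
                      ∀ cs → MiddleNonzero (Vec.map ι cs) → ¬ (Φ ∣ℚ[x] poly (shape t cs))
shape-not-divisible {p′} {t} 10≤p′ 4≤t {Φ} {σ} Φ≈G σ²≡1 σᵖσ≡1 cs middle (q , V≡Φq)
  with shape-reduce-zero (Vec.map ι cs) | shape-reduce-nonzero σ²≡1 (Vec.map ι cs) middle
  where open ShapeReduction p′ 10≤p′ σ 4≤t
... | k₁ , k₁≤p′ , vanishes | k₂ , k₂≤p′ , survives =
  survives (trans (sym (transport k₂)) (reduce-multiple-zero V≈G·q k₁≤p′ k₂≤p′ (trans (transport k₁) vanishes)))
  where
  open ℚ[x].Reduction p′ σ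
  open Multiples σ σ²≡1 σᵖσ≡1
  V = toℚ (poly (shape t cs))
  V≈G·q : V ≈ ℚ[x].mulP (geometric σ (suc p′)) q
  V≈G·q = ≈-trans (coeffwise V≡Φq) (mulP-congˡ q Φ≈G)
  transport : ∀ k → reduce k V ≡ reduce k (monomials (shape t (Vec.map ι cs)))
  transport k = reduce-cong k (≈-trans (toℚ-poly (shape t cs)) (≈-reflexive (cong monomials (map-shape ι t cs))))

-1ℚ : ℚ
-1ℚ = ℚ.- 1ℚ

lemma5p5 : (t p : ℕ) → 2 ∣ t → 4 ≤ t → Prime p → 11 ≤ p →
    (¬ (Φ p ∣ℚ[x] U t) × ¬ (Φ (2 ℕ.* p) ∣ℚ[x] U t))
    × (¬ (Φ p ∣ℚ[x] W t) × ¬ (Φ (2 ℕ.* p) ∣ℚ[x] W t))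
lemma5p5 t p@(suc p′) _ 4≤t pr (s≤s 10≤p′) =
  (Φp∤ coeffs-U middle-U , Φ2p∤ coeffs-U middle-U) , (Φp∤ coeffs-W middle-W , Φ2p∤ coeffs-W middle-W)
  where
  middle-U : MiddleNonzero (Vec.map ι coeffs-U)
  middle-U = (λ ()) , (λ ()) , (λ ())
  middle-W : MiddleNonzero (Vec.map ι coeffs-W)
  middle-W = (λ ()) , (λ ()) , (λ ())
  p≢2 : p ≢ 2
  p≢2 refl = ℕP.<⇒≱ (s≤s 10≤p′) (s≤s (s≤s z≤n))
  Φp∤ : ∀ cs → MiddleNonzero (Vec.map ι cs) → ¬ (Φ p ∣ℚ[x] poly (shape t cs))
  Φp∤ = shape-not-divisible 10≤p′ 4≤t (≈-trans (toℚ-cong (Φ-prime pr)) (toℚ-geometric (+ 1) p))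
                            refl (trans (ℚP.*-identityʳ _) (1^n≡1 p))
  Φ2p∤ : ∀ cs → MiddleNonzero (Vec.map ι cs) → ¬ (Φ (2 ℕ.* p) ∣ℚ[x] poly (shape t cs))
  Φ2p∤ = shape-not-divisible 10≤p′ 4≤t (≈-trans (toℚ-cong (Φ-twice-prime pr p≢2)) (toℚ-geometric -[1+ 0 ] p))
                             refl (trans (cong (λ n → -1ℚ ℚ[x].^ n ℚ.* -1ℚ) (odd-prime pr p≢2))
                                         (cong (λ x → (-1ℚ ℚ.* x) ℚ.* -1ℚ) (involution-^-even refl (p / 2))))
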